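{- Let $\mathcal{M}$ be a regular matroid on $E$ represented by a totally unimodular real matrix $M$. The map $\phi$ from the set of faces of the Voronoi cell $V_0$ to $\mathcal{SC}(\mathcal{M})$ is injective and order-preserving: if $F_1\subseteq F_2$ are faces of $V_0$ then $\phi(F_1)\le\phi(F_2)$.
   Context: $\mathcal{F}=\ker(M)$, $\Lambda=\mathcal{F}\cap\mathbb{Z}^E$, with the standard inner product $\langle\cdot,\cdot\rangle$ of $\mathbb{R}^E$; $V_0=\{x\in\mathcal{F}:\|x\|\le\|x-\mu\|\ \forall\mu\in\Lambda\}$. A nonzero $\gamma\in\mathcal{F}$ is Eulerian if all $\gamma_e\in\{ -1,0,1\}$; a circuit in $\Lambda$ is an Eulerian flow whose support is a circuit of $\mathcal{M}$ (minimal dependent set of columns); $\Xi$ is the set of circuits in $\Lambda$. For $\gamma\in\Xi$, $F_\gamma=\{x\in\mathcal{F}:2\langle x,\gamma\rangle=\|\gamma\|^2\}$. For a face $F$, $\mathcal{U}(F)=\{\gamma\in\Xi: F\subseteq F_\gamma\}$, and $\phi(F)$ is the pair consisting of the sub-matroid with base set $\bigcup_{\gamma\in\mathcal{U}(F)}\operatorname{supp}(\gamma)$ and the orientation $e\mapsto\operatorname{sgn}(\gamma_e)$ for any $\gamma\in\mathcal{U}(F)$ with $e\in\operatorname{supp}(\gamma)$ (these signs agree). An orientation $D:E'\to\{\pm1\}$ of a sub-matroid with base set $E'$ is strongly connected if for every $e\in E'$ there is $z_e\in(\mathbb{Z}_{\ge0})^{E'}$ with $e+z_e\in\ker(M_{E'}^D)$,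 where $M_{E'}^D$ has columns $D(e)c_e$, $e\in E'$. $\mathcal{SC}(\mathcal{M})$ is the set of pairs $(\mathcal{N},D)$ of a sub-matroid with a strongly connected orientation, ordered by $(\mathcal{N},D)\le(\mathcal{N}',D')$ iff the base set of $\mathcal{N}'$ is contained in that of $\mathcal{N}$ and $D'$ is the restriction of $D$.
   Formalization: The Voronoi cell $V_0$, the flow space $\mathcal{F}$, the sets $F_\gamma$ and the faces of $V_0$ (with their supporting functionals) are taken over ℚ^E instead of $\mathbb{R}^E$. -}

module Defs where

open import Level using (0ℓ)
open import Data.Nat as ℕ using (ℕ; zero; suc)
open import Data.Fin using (Fin; zero; suc; punchIn; toℕ)
open import Data.Integer as ℤ using (ℤ; _◃_)
open import Data.Sign using (Sign)
open import Data.Rational as ℚ using (ℚ; 0ℚ; _/_)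
open import Data.Product using (Σ; ∃; _×_)
open import Data.Sum using (_⊎_)
open import Function using (_∘_)
open import Function.Bundles using (_⇔_)
open import Relation.Binary.PropositionalEquality using (_≡_; _≢_)

-- Integer matrix with m rows and columns indexed by E = Fin n
Matrix : ℕ → ℕ → Set
Matrix m n = Fin m → Fin n → ℤ

QVec : ℕ → Set
QVec n = Fin n → ℚ

sumℚ : ∀ {n} → (Fin n → ℚ) → ℚ
sumℚ {zero}  f = 0ℚ
sumℚ {suc n} f = f zero ℚ.+ sumℚ (f ∘ suc)

sumℤ : ∀ {n} → (Fin n → ℤ) → ℤ
sumℤ {zero}  f = ℤ.0ℤ
sumℤ {suc n} f = f zero ℤ.+ sumℤ (f ∘ suc)

altSign : ∀ {k} → Fin k → ℤ
altSign zero    = ℤ.1ℤ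
altSign (suc j) = ℤ.- altSign j

det : ∀ {k} → (Fin k → Fin k → ℤ) → ℤ
det {zero}  A = ℤ.1ℤ
det {suc k} A = sumℤ (λ j → altSign j ℤ.* A zero j ℤ.* det (λ r c → A (suc r) (punchIn j c)))

-- every square submatrix has determinant in {-1,0,1}
-- (row/column selections need not be injective; repeated rows/columns give det 0)
TotallyUnimodular : ∀ {m n} → Matrix m n → Set
TotallyUnimodular {m} {n} M =
  ∀ (k : ℕ) (r : Fin k → Fin m) (c : Fin k → Fin n) →
  let d = det (λ i j → M (r i) (c j)) in
  (d ≡ ℤ.0ℤ) ⊎ (d ≡ ℤ.1ℤ) ⊎ (d ≡ ℤ.-1ℤ)

toQ : ℤ → ℚ
toQ z = z / 1

toQVec : ∀ {n} → (Fin n → ℤ) → QVec n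
toQVec v = toQ ∘ v

⟨_,_⟩ : ∀ {n} → QVec n → QVec n → ℚ
⟨ x , y ⟩ = sumℚ (λ i → x i ℚ.* y i)

‖_‖² : ∀ {n} → QVec n → ℚ
‖ x ‖² = ⟨ x , x ⟩

_-ᵥ_ : ∀ {n} → QVec n → QVec n → QVec n
(x -ᵥ y) i = x i ℚ.- y i

module _ {m n : ℕ} (M : Matrix m n) where

  InF : QVec n → Set
  InF x = ∀ i → sumℚ (λ e → toQ (M i e) ℚ.* x e) ≡ 0ℚ

  InV0 : QVec n → Set
  InV0 x = InF x × (∀ (μ : Fin n → ℤ) → InF (toQVec μ) → ‖ x ‖² ℚ.≤ ‖ x -ᵥ toQVec μ ‖²)

  -- γ ∈ Ξ : Eulerian flow in Λ whose support is a circuit of the matroid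
  IsCircuit : (Fin n → ℤ) → Set
  IsCircuit γ =
    (∀ e → (γ e ≡ ℤ.0ℤ) ⊎ (γ e ≡ ℤ.1ℤ) ⊎ (γ e ≡ ℤ.-1ℤ)) ×
    (∃ λ e → γ e ≢ ℤ.0ℤ) ×
    InF (toQVec γ) ×
    (∀ (y : QVec n) → InF y → (∀ e → γ e ≡ ℤ.0ℤ → y e ≡ 0ℚ) →
       (∃ λ e → γ e ≢ ℤ.0ℤ × y e ≡ 0ℚ) → ∀ e → y e ≡ 0ℚ)

  OnFγ : (Fin n → ℤ) → QVec n → Set
  OnFγ γ x = (ℤ.+ 2 / 1) ℚ.* ⟨ x , toQVec γ ⟩ ≡ ‖ toQVec γ ‖²

  -- (nonempty) faces of V₀, as subsets of ℚ^E given by a supporting hyperplane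
  IsFace : (QVec n → Set) → Set
  IsFace F = Σ (QVec n) λ c → Σ ℚ λ h →
    (∀ y → InV0 y → ⟨ c , y ⟩ ℚ.≤ h) ×
    (∀ x → F x ⇔ (InV0 x × ⟨ c , x ⟩ ≡ h)) ×
    (∃ λ x → F x)

  U : (QVec n → Set) → (Fin n → ℤ) → Set
  U F γ = IsCircuit γ × (∀ x → F x → OnFγ γ x)

  -- e in the base set of the sub-matroid of φ(F)
  InBase : (QVec n → Set) → Fin n → Set
  InBase F e = ∃ λ γ → U F γ × γ e ≢ ℤ.0ℤ

  -- graph of the orientation of φ(F): D(e) = s
  Orient : (QVec n → Set) → Fin n → Sign → Set
  Orient F e s = ∃ λ γ → U F γ × γ e ≡ s ◃ 1

  -- φ(F) ∈ 𝒮𝒞(𝓜): for each e ∈ E' there is w = e + z, z ≥ 0 supported in E',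
  -- with Σ_f D(f) w_f c_f = 0
  PhiStronglyConnected : (QVec n → Set) → Set
  PhiStronglyConnected F = ∀ e → InBase F e →
    Σ (Fin n → ℕ) λ w → Σ (Fin n → Sign) λ σ →
      (1 ℕ.≤ w e) ×
      (∀ f → w f ≢ 0 → InBase F f × Orient F f (σ f)) ×
      (∀ i → sumℤ (λ f → M i f ℤ.* (σ f ◃ w f)) ≡ ℤ.0ℤ)

  PhiLE : (QVec n → Set) → (QVec n → Set) → Set
  PhiLE F₁ F₂ = (∀ e → InBase F₂ e → InBase F₁ e) ×
                (∀ e s → Orient F₂ e s → Orient F₁ e s)

  PhiEq : (QVec n → Set) → (QVec n → Set) → Set
  PhiEq F₁ F₂ = (∀ e → InBase F₁ e ⇔ InBase F₂ e) ×
                (∀ e s → Orient F₁ e s ⇔ Orient F₂ e s)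

module Submission where

-- Write 𝒰(F) for the circuits γ whose hyperplanes F_γ contain the face F. Monotonicity of φ is
-- immediate, and each γ ∈ 𝒰(F) is itself the positive dependency required for strong connectivity.
--
-- Injectivity rests on total unimodularity through Cramer's rule: a kernel vector of minimal
-- support is a multiple of a {0, ±1}-vector, so every lattice vector μ is a conformal sum of
-- circuits. Hence V₀ is cut out by the circuit inequalities 2⟨x, γ⟩ ≤ ‖γ‖², and on V₀ every μ ∈ Λ
-- satisfies 2⟨x, μ⟩ ≤ ‖μ‖₁. Two consequences:
--   (A) F = V₀ ∩ ⋂_{γ ∈ 𝒰(F)} F_γ. Take a point of F lying on no circuit hyperplane other than
--       those of 𝒰(F); pushing it slightly away from a candidate y stays in V₀, which forces y onto
--       the supporting hyperplane of F.
--   (B) If each signed element of a circuit γ lies in a circuit whose hyperplane contains x ∈ V₀,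
--       then so does the hyperplane of γ: the sum of those circuits attains 2⟨x, ·⟩ = ‖·‖₁ without
--       any cancellation, so γ splits off it with equality.
-- If φ(F₁) = φ(F₂), then (B) puts every x ∈ F₁ on the hyperplanes of 𝒰(F₂), and (A) gives x ∈ F₂.

open import Level using (0ℓ)
open import Data.Empty using (⊥; ⊥-elim)
open import Data.Fin as Fin using (Fin; zero; suc; punchIn; inject₁)
open import Data.Fin.Induction using (<-weakInduction)
import Data.Fin.Properties as FinP
open import Data.Integer as ℤ using (ℤ; -[1+_]; _◃_)
import Data.Integer.Properties as ℤP
import Data.Integer.Solver as ℤSolver
open import Data.List using (List; []; _∷_; _++_; map)
open import Data.List.Relation.Unary.All as All using (All; []; _∷_)
open import Data.List.Relation.Unary.Any as Any using (Any; here; there)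
import Data.List.Relation.Unary.Any.Properties as AnyP
open import Data.Nat as ℕ using (ℕ; zero; suc)
import Data.Nat.Properties as ℕP
open import Data.Product using (Σ; ∃; _×_; _,_; proj₁; proj₂)
open import Data.Rational as ℚ using (ℚ; 0ℚ; 1ℚ; _+_; _*_; -_; _-_; _≤_; _<_; ∣_∣; ½; _⊓_)
import Data.Rational.Properties as ℚP
open import Data.Rational.Solver using (module +-*-Solver)
import Data.Rational.Unnormalised as ℚᵘ
import Data.Rational.Unnormalised.Properties as ℚᵘP
open import Data.Sum using (_⊎_; inj₁; inj₂)
open import Data.Vec.Functional using () renaming (_∷_ to _∷ᵥ_)
open import Effect.Monad using (RawMonad)
open import Function using (_∘_)
open import Function.Bundles using (_⇔_; mk⇔; Equivalence)
open import Function.Definitions using (Injective)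
open import Relation.Binary.Definitions using (tri<; tri≈; tri>)
open import Relation.Binary.PropositionalEquality
open import Relation.Nullary using (¬_; Dec; yes; no; ¬?; _×-dec_)
open import Relation.Nullary.Decidable using (¬¬-excluded-middle; decidable-stable; from-yes)
open import Relation.Nullary.Negation using (¬¬-Monad)
open import Algebra.Properties.CommutativeMonoid.Sum ℕP.+-0-commutativeMonoid
  using (∑-distrib-+; sum-cong-≗) renaming (sum to sumℕ)
open import Algebra.Properties.Ring ℚP.+-*-ring using (-‿involutive; x∙y⁻¹≈ε⇒x≈y)

open import Defs

open RawMonad (¬¬-Monad {0ℓ}) using (_>>=_; return)

-- Rational arithmetic and finite sums

-- toQ z = z / 1 is normalised by a gcd computation; in ℚᵘ it is just z / 1 and the ring laws compute.
private
  ι : ℤ → ℚᵘ.ℚᵘ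
  ι z = ℚᵘ.mkℚᵘ z 0

  toℚᵘ-toQ : ∀ z → ℚ.toℚᵘ (toQ z) ℚᵘ.≃ ι z
  toℚᵘ-toQ z = ℚP.toℚᵘ-fromℚᵘ (ι z)

  ι-+ : ∀ a b → ι (a ℤ.+ b) ℚᵘ.≃ (ι a ℚᵘ.+ ι b)
  ι-+ a b = ℚᵘ.*≡* (solve 2 (λ a b → (a :+ b) :* con ℤ.1ℤ := (a :* con ℤ.1ℤ :+ b :* con ℤ.1ℤ) :* con ℤ.1ℤ) refl a b)
    where open ℤSolver.+-*-Solver

  ι-* : ∀ a b → ι (a ℤ.* b) ℚᵘ.≃ (ι a ℚᵘ.* ι b)
  ι-* a b = ℚᵘ.*≡* refl

toQ-+ : ∀ a b → toQ (a ℤ.+ b) ≡ toQ a + toQ b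
toQ-+ a b = ℚP.toℚᵘ-injective (begin-equality
  ℚ.toℚᵘ (toQ (a ℤ.+ b))            ≃⟨ toℚᵘ-toQ (a ℤ.+ b) ⟩
  ι (a ℤ.+ b)                       ≃⟨ ι-+ a b ⟩
  ι a ℚᵘ.+ ι b                      ≃⟨ ℚᵘP.+-cong (toℚᵘ-toQ a) (toℚᵘ-toQ b) ⟨
  ℚ.toℚᵘ (toQ a) ℚᵘ.+ ℚ.toℚᵘ (toQ b) ≃⟨ ℚP.toℚᵘ-homo-+ (toQ a) (toQ b) ⟨
  ℚ.toℚᵘ (toQ a + toQ b)            ∎)
  where open ℚᵘP.≤-Reasoning

toQ-* : ∀ a b → toQ (a ℤ.* b) ≡ toQ a * toQ b
toQ-* a b = ℚP.toℚᵘ-injective (begin-equality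
  ℚ.toℚᵘ (toQ (a ℤ.* b))            ≃⟨ toℚᵘ-toQ (a ℤ.* b) ⟩
  ι (a ℤ.* b)                       ≃⟨ ι-* a b ⟩
  ι a ℚᵘ.* ι b                      ≃⟨ ℚᵘP.*-cong (toℚᵘ-toQ a) (toℚᵘ-toQ b) ⟨
  ℚ.toℚᵘ (toQ a) ℚᵘ.* ℚ.toℚᵘ (toQ b) ≃⟨ ℚP.toℚᵘ-homo-* (toQ a) (toQ b) ⟨
  ℚ.toℚᵘ (toQ a * toQ b)            ∎)
  where open ℚᵘP.≤-Reasoning

toQ-neg : ∀ a → toQ (ℤ.- a) ≡ - toQ a
toQ-neg a = ℚP.toℚᵘ-injective (begin-equality
  ℚ.toℚᵘ (toQ (ℤ.- a))   ≃⟨ toℚᵘ-toQ (ℤ.- a) ⟩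
  ι (ℤ.- a)              ≃⟨ ℚᵘP.-‿cong (toℚᵘ-toQ a) ⟨
  ℚᵘ.- ℚ.toℚᵘ (toQ a)    ≃⟨ ℚP.toℚᵘ-homo‿- (toQ a) ⟨
  ℚ.toℚᵘ (- toQ a)       ∎)
  where open ℚᵘP.≤-Reasoning

toQ-injective : ∀ {a b} → toQ a ≡ toQ b → a ≡ b
toQ-injective {a} {b} eq with ℚᵘP.≃-trans (ℚᵘP.≃-sym (toℚᵘ-toQ a)) (ℚᵘP.≃-trans (ℚP.toℚᵘ-cong eq) (toℚᵘ-toQ b))
... | ℚᵘ.*≡* e = trans (sym (ℤP.*-identityʳ a)) (trans e (ℤP.*-identityʳ b))

toQ-mono-≤ : ∀ {a b} → a ℤ.≤ b → toQ a ≤ toQ b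
toQ-mono-≤ {a} {b} le = ℚP.toℚᵘ-cancel-≤ (ℚᵘP.≤-respʳ-≃ (ℚᵘP.≃-sym (toℚᵘ-toQ b)) (ℚᵘP.≤-respˡ-≃ (ℚᵘP.≃-sym (toℚᵘ-toQ a))
  (ℚᵘ.*≤* (subst₂ ℤ._≤_ (sym (ℤP.*-identityʳ a)) (sym (ℤP.*-identityʳ b)) le))))

toQ-cancel-≤ : ∀ {a b} → toQ a ≤ toQ b → a ℤ.≤ b
toQ-cancel-≤ {a} {b} le with ℚᵘP.≤-respʳ-≃ (toℚᵘ-toQ b) (ℚᵘP.≤-respˡ-≃ (toℚᵘ-toQ a) (ℚP.toℚᵘ-mono-≤ le))
... | ℚᵘ.*≤* e = subst₂ ℤ._≤_ (ℤP.*-identityʳ a) (ℤP.*-identityʳ b) e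

toQ-cancel-< : ∀ {a b} → toQ a < toQ b → a ℤ.< b
toQ-cancel-< lt = ℤP.≰⇒> (λ b≤a → ℚP.<-irrefl refl (ℚP.<-≤-trans lt (toQ-mono-≤ b≤a)))

sumℚ-cong : ∀ {k} {f g : Fin k → ℚ} → (∀ i → f i ≡ g i) → sumℚ f ≡ sumℚ g
sumℚ-cong {zero}  f≗g = refl
sumℚ-cong {suc k} f≗g = cong₂ _+_ (f≗g zero) (sumℚ-cong (f≗g ∘ suc))

sumℚ-0 : ∀ {k} → sumℚ {k} (λ _ → 0ℚ) ≡ 0ℚ
sumℚ-0 {zero}  = refl
sumℚ-0 {suc k} = trans (ℚP.+-identityˡ _) (sumℚ-0 {k})

sumℚ-+ : ∀ {k} (f g : Fin k → ℚ) → sumℚ (λ i → f i + g i) ≡ sumℚ f + sumℚ g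
sumℚ-+ {zero}  f g = refl
sumℚ-+ {suc k} f g = trans (cong (f zero + g zero +_) (sumℚ-+ (f ∘ suc) (g ∘ suc)))
  (solve 4 (λ a b c d → (a :+ b) :+ (c :+ d) := (a :+ c) :+ (b :+ d)) refl (f zero) (g zero) (sumℚ (f ∘ suc)) (sumℚ (g ∘ suc)))
  where open +-*-Solver

sumℚ-*ˡ : ∀ {k} c (f : Fin k → ℚ) → sumℚ (λ i → c * f i) ≡ c * sumℚ f
sumℚ-*ˡ {zero}  c f = sym (ℚP.*-zeroʳ c)
sumℚ-*ˡ {suc k} c f = trans (cong (c * f zero +_) (sumℚ-*ˡ c (f ∘ suc))) (sym (ℚP.*-distribˡ-+ c _ _))

sumℚ-neg : ∀ {k} (f : Fin k → ℚ) → sumℚ (λ i → - f i) ≡ - sumℚ f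
sumℚ-neg {zero}  f = refl
sumℚ-neg {suc k} f = trans (cong (- f zero +_) (sumℚ-neg (f ∘ suc))) (sym (ℚP.neg-distrib-+ (f zero) (sumℚ (f ∘ suc))))

sumℚ-mono-≤ : ∀ {k} {f g : Fin k → ℚ} → (∀ i → f i ≤ g i) → sumℚ f ≤ sumℚ g
sumℚ-mono-≤ {zero}  f≤g = ℚP.≤-refl
sumℚ-mono-≤ {suc k} f≤g = ℚP.+-mono-≤ (f≤g zero) (sumℚ-mono-≤ (f≤g ∘ suc))

sumℚ-comm : ∀ {k l} (f : Fin k → Fin l → ℚ) → sumℚ (λ i → sumℚ (f i)) ≡ sumℚ (λ j → sumℚ (λ i → f i j))
sumℚ-comm {zero}  {l} f = sym (sumℚ-0 {l})
sumℚ-comm {suc k}     f = trans (cong (sumℚ (f zero) +_) (sumℚ-comm (f ∘ suc)))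
  (sym (sumℚ-+ (f zero) (λ j → sumℚ (λ i → f (suc i) j))))

toQ-sumℤ : ∀ {k} (f : Fin k → ℤ) → toQ (sumℤ f) ≡ sumℚ (toQ ∘ f)
toQ-sumℤ {zero}  f = refl
toQ-sumℤ {suc k} f = trans (toQ-+ (f zero) (sumℤ (f ∘ suc))) (cong (toQ (f zero) +_) (toQ-sumℤ (f ∘ suc)))

δ : ∀ {k} → Fin k → Fin k → ℚ
δ a i with a Fin.≟ i
... | yes _ = 1ℚ
... | no  _ = 0ℚ

δ-refl : ∀ {k} (a : Fin k) → δ a a ≡ 1ℚ
δ-refl a with a Fin.≟ a
... | yes _  = refl
... | no a≢a = ⊥-elim (a≢a refl)

δ-≢ : ∀ {k} {a b : Fin k} → a ≢ b → δ a b ≡ 0ℚ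
δ-≢ {a = a} {b} a≢b with a Fin.≟ b
... | yes a≡b = ⊥-elim (a≢b a≡b)
... | no  _   = refl

δ-sym : ∀ {k} (a b : Fin k) → δ a b ≡ δ b a
δ-sym a b with a Fin.≟ b
... | yes refl = sym (δ-refl a)
... | no  a≢b  = sym (δ-≢ (a≢b ∘ sym))

sumℚ-δ-1 : ∀ {k} (a : Fin k) → sumℚ (δ a) ≡ 1ℚ
sumℚ-δ-1 {suc k} zero = cong₂ _+_ (δ-refl {suc k} zero) (trans (sumℚ-cong (λ i → δ-≢ {suc k} {zero} {suc i} λ ())) (sumℚ-0 {k}))
sumℚ-δ-1 {suc k} (suc a) = trans (cong₂ _+_ (δ-≢ {suc k} {suc a} {zero} λ ()) (sumℚ-cong (λ i → δ-suc a i))) (trans (ℚP.+-identityˡ _) (sumℚ-δ-1 a))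
  where
  δ-suc : ∀ {k} (a i : Fin k) → δ (suc a) (suc i) ≡ δ a i
  δ-suc a i = by-cases (a Fin.≟ i)
    where
    by-cases : Dec (a ≡ i) → δ (suc a) (suc i) ≡ δ a i
    by-cases (yes refl) = trans (δ-refl (suc a)) (sym (δ-refl a))
    by-cases (no a≢i)   = trans (δ-≢ (a≢i ∘ FinP.suc-injective)) (sym (δ-≢ a≢i))

sumℚ-δ : ∀ {k} (a : Fin k) (g : Fin k → ℚ) → sumℚ (λ i → δ a i * g i) ≡ g a
sumℚ-δ {suc k} a g = begin
  sumℚ (λ i → δ a i * g i) ≡⟨ sumℚ-cong pointwise ⟩
  sumℚ (λ i → δ a i * g a) ≡⟨ trans (sumℚ-cong (λ i → ℚP.*-comm (δ a i) (g a))) (sumℚ-*ˡ (g a) (δ a)) ⟩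
  g a * sumℚ (δ a)         ≡⟨ cong (g a *_) (sumℚ-δ-1 a) ⟩
  g a * 1ℚ                 ≡⟨ ℚP.*-identityʳ (g a) ⟩
  g a                      ∎
  where
  open ≡-Reasoning
  pointwise : ∀ i → δ a i * g i ≡ δ a i * g a
  pointwise i with a Fin.≟ i
  ... | yes refl = refl
  ... | no  _    = trans (ℚP.*-zeroˡ (g i)) (sym (ℚP.*-zeroˡ (g a)))

p*q≡0⇒q≡0 : ∀ {p q} → p ≢ 0ℚ → p * q ≡ 0ℚ → q ≡ 0ℚ
p*q≡0⇒q≡0 {p} {q} p≢0 pq≡0 = begin
  q                ≡⟨ ℚP.*-identityˡ q ⟨
  1ℚ * q           ≡⟨ cong (_* q) (ℚP.*-inverseˡ p) ⟨
  (ℚ.1/ p * p) * q ≡⟨ ℚP.*-assoc (ℚ.1/ p) p q ⟩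
  ℚ.1/ p * (p * q) ≡⟨ cong (ℚ.1/ p *_) pq≡0 ⟩
  ℚ.1/ p * 0ℚ      ≡⟨ ℚP.*-zeroʳ (ℚ.1/ p) ⟩
  0ℚ               ∎
  where
  open ≡-Reasoning
  instance _ = ℚ.≢-nonZero p≢0

0≤p⇒p≡0⊎0<p : ∀ {p} → 0ℚ ≤ p → p ≡ 0ℚ ⊎ 0ℚ < p
0≤p⇒p≡0⊎0<p {p} 0≤p with ℚP.<-cmp p 0ℚ
... | tri< p<0 _ _ = ⊥-elim (ℚP.<-irrefl refl (ℚP.<-≤-trans p<0 0≤p))
... | tri≈ _ p≡0 _ = inj₁ p≡0
... | tri> _ _ p>0 = inj₂ p>0

p≤q⇒0≤q-p : ∀ {p q} → p ≤ q → 0ℚ ≤ q - p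
p≤q⇒0≤q-p {p} {q} p≤q = subst (_≤ q - p) (ℚP.+-inverseʳ p) (ℚP.+-monoˡ-≤ (- p) p≤q)

0≤q-p⇒p≤q : ∀ {p q} → 0ℚ ≤ q - p → p ≤ q
0≤q-p⇒p≤q {p} {q} 0≤q-p = subst₂ _≤_ (ℚP.+-identityʳ p) (solve 2 (λ p q → p :+ (q :- p) := q) refl p q) (ℚP.+-monoʳ-≤ p 0≤q-p)
  where open +-*-Solver

pos*pos : ∀ {p q} → 0ℚ < p → 0ℚ < q → 0ℚ < p * q
pos*pos {p} {q} p>0 q>0 = ℚP.positive⁻¹ _ {{ℚP.pos*pos⇒pos p {{ℚ.positive p>0}} q {{ℚ.positive q>0}}}}

nonNeg*nonNeg : ∀ {p q} → 0ℚ ≤ p → 0ℚ ≤ q → 0ℚ ≤ p * q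
nonNeg*nonNeg {p} {q} p≥0 q≥0 = ℚP.nonNegative⁻¹ _ {{ℚP.nonNeg*nonNeg⇒nonNeg p {{ℚ.nonNegative p≥0}} q {{ℚ.nonNegative q≥0}}}}

-- 1/p, with the junk value 0 at p = 0
inv : ℚ → ℚ
inv p with p ℚ.≟ 0ℚ
... | yes _   = 0ℚ
... | no  p≢0 = ℚ.1/_ p {{ℚ.≢-nonZero p≢0}}

*-inv : ∀ {p} → p ≢ 0ℚ → p * inv p ≡ 1ℚ
*-inv {p} p≢0 with p ℚ.≟ 0ℚ
... | yes p≡0  = ⊥-elim (p≢0 p≡0)
... | no  p≢0′ = ℚP.*-inverseʳ p {{ℚ.≢-nonZero p≢0′}}

0<inv : ∀ {p} → 0ℚ < p → 0ℚ < inv p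
0<inv {p} p>0 = ℚP.*-cancelˡ-<-nonNeg p {{ℚ.nonNegative (ℚP.<⇒≤ p>0)}}
  (subst₂ _<_ (sym (ℚP.*-zeroʳ p)) (sym (*-inv (λ p≡0 → ℚP.<-irrefl (sym p≡0) p>0))) (from-yes (0ℚ ℚP.<? 1ℚ)))

0≤p*p : ∀ p → 0ℚ ≤ p * p
0≤p*p p with ℚP.<-cmp p 0ℚ
... | tri< p<0 _ _ = ℚP.<⇒≤ (ℚP.positive⁻¹ _ {{ℚP.neg*neg⇒pos p {{ℚ.negative p<0}} p {{ℚ.negative p<0}}}})
... | tri≈ _ p≡0 _ = ℚP.≤-reflexive (sym (trans (cong (p *_) p≡0) (ℚP.*-zeroʳ p)))
... | tri> _ _ p>0 = ℚP.<⇒≤ (pos*pos p>0 p>0)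

nonNeg*nonPos : ∀ {p q} → 0ℚ ≤ p → q ≤ 0ℚ → p * q ≤ 0ℚ
nonNeg*nonPos {p} {q} p≥0 q≤0 = ℚP.nonPositive⁻¹ _ {{ℚP.nonNeg*nonPos⇒nonPos p {{ℚ.nonNegative p≥0}} q {{ℚ.nonPositive q≤0}}}}

+-≤-≡⇒≡ˡ : ∀ {a b c d} → a ≤ c → b ≤ d → a + b ≡ c + d → a ≡ c
+-≤-≡⇒≡ˡ {a} {b} {c} {d} a≤c b≤d a+b≡c+d = ℚP.≤-antisym a≤c (0≤q-p⇒p≤q (subst (0ℚ ≤_) d-b≡a-c (p≤q⇒0≤q-p b≤d)))
  where
  open +-*-Solver
  d-b≡a-c : d - b ≡ a - c
  d-b≡a-c = begin
    d - b                       ≡⟨ solve 4 (λ a b c d → d :- b := a :- c :+ ((c :+ d) :- (a :+ b))) refl a b c d ⟩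
    a - c + ((c + d) - (a + b)) ≡⟨ cong (λ s → a - c + (s - (a + b))) a+b≡c+d ⟨
    a - c + ((a + b) - (a + b)) ≡⟨ cong (a - c +_) (ℚP.+-inverseʳ (a + b)) ⟩
    a - c + 0ℚ                  ≡⟨ ℚP.+-identityʳ (a - c) ⟩
    a - c                       ∎
    where open ≡-Reasoning

-- Determinants over ℚ

SqMatrixℚ : ℕ → Set
SqMatrixℚ k = Fin k → Fin k → ℚ

altSignℚ : ∀ {k} → Fin k → ℚ
altSignℚ zero    = 1ℚ
altSignℚ (suc j) = - altSignℚ j

laplaceTerm : ∀ {k} → SqMatrixℚ (suc k) → (SqMatrixℚ k → ℚ) → Fin (suc k) → ℚ
laplaceTerm A d j = altSignℚ j * A zero j * d (λ r c → A (suc r) (punchIn j c))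

detℚ : ∀ {k} → SqMatrixℚ k → ℚ
detℚ {zero}  A = 1ℚ
detℚ {suc k} A = sumℚ (laplaceTerm A detℚ)

toQ-altSign : ∀ {k} (j : Fin k) → toQ (altSign j) ≡ altSignℚ j
toQ-altSign zero    = refl
toQ-altSign (suc j) = trans (toQ-neg (altSign j)) (cong -_ (toQ-altSign j))

toQ-det : ∀ {k} (A : Fin k → Fin k → ℤ) → toQ (det A) ≡ detℚ (λ a b → toQ (A a b))
toQ-det {zero}  A = refl
toQ-det {suc k} A = trans (toQ-sumℤ (λ j → altSign j ℤ.* A zero j ℤ.* det (minor j))) (sumℚ-cong λ j →
  trans (toQ-* (altSign j ℤ.* A zero j) (det (minor j)))
        (cong₂ _*_ (trans (toQ-* (altSign j) (A zero j)) (cong (_* toQ (A zero j)) (toQ-altSign j)))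
                   (toQ-det (minor j))))
  where
  minor : Fin (suc k) → Fin k → Fin k → ℤ
  minor j r c = A (suc r) (punchIn j c)

detℚ-cong : ∀ {k} {A B : SqMatrixℚ k} → (∀ a b → A a b ≡ B a b) → detℚ A ≡ detℚ B
detℚ-cong {zero}  A≗B = refl
detℚ-cong {suc k} A≗B = sumℚ-cong λ j →
  cong₂ _*_ (cong (altSignℚ j *_) (A≗B zero j)) (detℚ-cong (λ r c → A≗B (suc r) (punchIn j c)))

swap : ∀ {k} → Fin (suc k) → Fin (suc (suc k)) → Fin (suc (suc k))
swap         zero    zero          = suc zero
swap         zero    (suc zero)    = zero
swap         zero    (suc (suc b)) = suc (suc b)
swap {suc k} (suc p) zero          = zero
swap {suc k} (suc p) (suc b)       = suc (swap p b)

swap-inject₁ : ∀ {k} (p : Fin (suc k)) → swap p (inject₁ p) ≡ suc p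
swap-inject₁         zero    = refl
swap-inject₁ {suc k} (suc p) = cong suc (swap-inject₁ p)

sumℚ-swap : ∀ {k} (p : Fin (suc k)) (f : Fin (suc (suc k)) → ℚ) → sumℚ (f ∘ swap p) ≡ sumℚ f
sumℚ-swap         zero    f = solve 3 (λ a b c → b :+ (a :+ c) := a :+ (b :+ c)) refl (f zero) (f (suc zero)) (sumℚ (λ l → f (suc (suc l))))
  where open +-*-Solver
sumℚ-swap {suc k} (suc p) f = cong (f zero +_) (sumℚ-swap p (f ∘ suc))

-- How swap p looks from the minor obtained by deleting column l: either l is one of the swapped
-- columns, and the minor is unchanged while the sign flips, or the minor sees a smaller swap.
data SwapView : ∀ {k} → Fin (suc k) → Fin (suc (suc k)) → Set where
  moved : ∀ {k} {p : Fin (suc k)} {l} → altSignℚ (swap p l) ≡ - altSignℚ l →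
          (∀ c → swap p (punchIn l c) ≡ punchIn (swap p l) c) → SwapView p l
  fixed : ∀ {k} {p : Fin (suc (suc k))} {l} (q : Fin (suc k)) → swap p l ≡ l →
          (∀ c → swap p (punchIn l c) ≡ punchIn l (swap q c)) → SwapView p l

swapView : ∀ {k} (p : Fin (suc k)) (l : Fin (suc (suc k))) → SwapView p l
swapView zero zero = moved refl λ { zero → refl ; (suc c) → refl }
swapView zero (suc zero) = moved (sym (-‿involutive 1ℚ)) λ { zero → refl ; (suc c) → refl }
swapView {suc k} zero (suc (suc l)) = fixed zero refl λ { zero → refl ; (suc zero) → refl ; (suc (suc c)) → refl }
swapView {suc k} (suc p) zero = fixed p refl λ c → refl
swapView {suc k} (suc p) (suc l) with swapView p l
... | moved flip punch = moved (cong -_ flip) λ { zero → refl ; (suc c) → cong suc (punch c) }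
... | fixed q fix punch = fixed (suc q) (cong suc fix) λ { zero → refl ; (suc c) → cong suc (punch c) }

mutual
  detℚ-swap : ∀ {k} (p : Fin (suc k)) (A : SqMatrixℚ (suc (suc k))) → detℚ (λ a b → A a (swap p b)) ≡ - detℚ A
  detℚ-swap p A = begin
    sumℚ (laplaceTerm (λ a b → A a (swap p b)) detℚ)  ≡⟨ sumℚ-cong (laplaceTerm-swap p A) ⟩
    sumℚ (λ l → - laplaceTerm A detℚ (swap p l))      ≡⟨ sumℚ-neg (laplaceTerm A detℚ ∘ swap p) ⟩
    - sumℚ (laplaceTerm A detℚ ∘ swap p)              ≡⟨ cong -_ (sumℚ-swap p (laplaceTerm A detℚ)) ⟩
    - detℚ A                                           ∎
    where open ≡-Reasoning

  laplaceTerm-swap : ∀ {k} (p : Fin (suc k)) (A : SqMatrixℚ (suc (suc k))) (l : Fin (suc (suc k))) →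
    laplaceTerm (λ a b → A a (swap p b)) detℚ l ≡ - laplaceTerm A detℚ (swap p l)
  laplaceTerm-swap p A l with swapView p l
  ... | moved flip punch = trans
    (cong₂ (λ s d → s * A zero (swap p l) * d)
           (trans (sym (-‿involutive (altSignℚ l))) (cong -_ (sym flip)))
           (detℚ-cong (λ r c → cong (A (suc r)) (punch c))))
    (solve 3 (λ s a d → (:- s) :* a :* d := :- (s :* a :* d)) refl (altSignℚ (swap p l)) (A zero (swap p l)) _)
    where open +-*-Solver
  ... | fixed q fix punch rewrite fix = trans
    (cong (altSignℚ l * A zero l *_)
          (trans (detℚ-cong (λ r c → cong (A (suc r)) (punch c))) (detℚ-swap q (λ r c → A (suc r) (punchIn l c)))))
    (solve 3 (λ s a d → s :* a :* (:- d) := :- (s :* a :* d)) refl (altSignℚ l) (A zero l) _)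
    where open +-*-Solver

x≡-x⇒x≡0 : ∀ {x} → x ≡ - x → x ≡ 0ℚ
x≡-x⇒x≡0 {x} x≡-x = begin
  x             ≡⟨ solve 1 (λ x → x := con ½ :* (x :+ x)) refl x ⟩
  ½ * (x + x)   ≡⟨ cong (λ y → ½ * (x + y)) x≡-x ⟩
  ½ * (x + - x) ≡⟨ cong (½ *_) (ℚP.+-inverseʳ x) ⟩
  ½ * 0ℚ        ≡⟨ ℚP.*-zeroʳ ½ ⟩
  0ℚ            ∎
  where open ≡-Reasoning
        open +-*-Solver

private
  ColumnsEqual : ∀ {k} → Fin (suc k) → Set
  ColumnsEqual {k} j = ∀ (A : SqMatrixℚ (suc (suc k))) → (∀ a → A a zero ≡ A a (suc j)) → detℚ A ≡ 0ℚ

  columns-0-1 : ∀ {k} → ColumnsEqual {k} zero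
  columns-0-1 A A₀≡A₁ = x≡-x⇒x≡0 (trans (detℚ-cong swap-invariant) (detℚ-swap zero A))
    where
    swap-invariant : ∀ a b → A a b ≡ A a (swap zero b)
    swap-invariant a zero          = A₀≡A₁ a
    swap-invariant a (suc zero)    = sym (A₀≡A₁ a)
    swap-invariant a (suc (suc b)) = refl

  columns-step : ∀ {k} (i : Fin k) → ColumnsEqual (inject₁ i) → ColumnsEqual (suc i)
  columns-step {suc k} i ih A A₀≡Aᵢ = begin
    detℚ A       ≡⟨ -‿involutive (detℚ A) ⟨
    - - detℚ A   ≡⟨ cong -_ (detℚ-swap (suc i) A) ⟨
    - detℚ A′    ≡⟨ cong -_ (ih A′ λ a → trans (A₀≡Aᵢ a) (cong (A a ∘ suc) (sym (swap-inject₁ i)))) ⟩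
    - 0ℚ         ≡⟨⟩
    0ℚ           ∎
    where
    open ≡-Reasoning
    A′ : SqMatrixℚ (suc (suc (suc k)))
    A′ a b = A a (swap (suc i) b)

detℚ-equal-columns : ∀ {k} (j : Fin (suc k)) (A : SqMatrixℚ (suc (suc k))) →
  (∀ a → A a zero ≡ A a (suc j)) → detℚ A ≡ 0ℚ
detℚ-equal-columns = <-weakInduction ColumnsEqual columns-0-1 columns-step

setCol₀ : ∀ {k} → SqMatrixℚ (suc k) → (Fin (suc k) → ℚ) → SqMatrixℚ (suc k)
setCol₀ A u a zero    = u a
setCol₀ A u a (suc b) = A a (suc b)

minor-setCol₀ : ∀ {k} (A : SqMatrixℚ (suc (suc k))) (u : Fin (suc (suc k)) → ℚ) (l : Fin (suc k)) r c →
  setCol₀ A u (suc r) (punchIn (suc l) c) ≡ setCol₀ (λ r c → A (suc r) (punchIn (suc l) c)) (u ∘ suc) r c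
minor-setCol₀ A u l r zero    = refl
minor-setCol₀ A u l r (suc c) = refl

mutual
  detℚ-setCol₀-linear : ∀ {k} (A : SqMatrixℚ (suc k)) x (u v : Fin (suc k) → ℚ) →
    detℚ (setCol₀ A (λ a → x * u a + v a)) ≡ x * detℚ (setCol₀ A u) + detℚ (setCol₀ A v)
  detℚ-setCol₀-linear {k} A x u v = begin
    sumℚ (T (λ a → x * u a + v a))      ≡⟨ sumℚ-cong (laplaceTerm-setCol₀-linear A x u v) ⟩
    sumℚ (λ l → x * T u l + T v l)      ≡⟨ sumℚ-+ (λ l → x * T u l) (T v) ⟩
    sumℚ (λ l → x * T u l) + sumℚ (T v) ≡⟨ cong (_+ sumℚ (T v)) (sumℚ-*ˡ x (T u)) ⟩
    x * sumℚ (T u) + sumℚ (T v)         ∎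
    where
    open ≡-Reasoning
    T : (Fin (suc k) → ℚ) → Fin (suc k) → ℚ
    T u = laplaceTerm (setCol₀ A u) detℚ

  laplaceTerm-setCol₀-linear : ∀ {k} (A : SqMatrixℚ (suc k)) x (u v : Fin (suc k) → ℚ) l →
    laplaceTerm (setCol₀ A (λ a → x * u a + v a)) detℚ l ≡ x * laplaceTerm (setCol₀ A u) detℚ l + laplaceTerm (setCol₀ A v) detℚ l
  laplaceTerm-setCol₀-linear {k} A x u v zero =
    solve 5 (λ s x u v d → s :* (x :* u :+ v) :* d := x :* (s :* u :* d) :+ s :* v :* d) refl
            (altSignℚ {suc k} zero) x (u zero) (v zero) (detℚ (λ r c → A (suc r) (suc c)))
    where open +-*-Solver
  laplaceTerm-setCol₀-linear {suc k} A x u v (suc l) = trans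
    (cong (altSignℚ (suc l) * A zero (suc l) *_) (begin
      detℚ (λ r c → setCol₀ A w (suc r) (punchIn (suc l) c))           ≡⟨ detℚ-cong (minor-setCol₀ A w l) ⟩
      detℚ (setCol₀ minor (w ∘ suc))                                    ≡⟨ detℚ-setCol₀-linear minor x (u ∘ suc) (v ∘ suc) ⟩
      x * detℚ (setCol₀ minor (u ∘ suc)) + detℚ (setCol₀ minor (v ∘ suc)) ≡⟨ cong₂ (λ p q → x * p + q)
                                                                            (detℚ-cong (λ r c → sym (minor-setCol₀ A u l r c)))
                                                                            (detℚ-cong (λ r c → sym (minor-setCol₀ A v l r c))) ⟩
      x * Dᵤ + Dᵥ                                                         ∎))
    (solve 4 (λ s x Dᵤ Dᵥ → s :* (x :* Dᵤ :+ Dᵥ) := x :* (s :* Dᵤ) :+ s :* Dᵥ) refl (altSignℚ (suc l) * A zero (suc l)) x Dᵤ Dᵥ)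
    where
    open ≡-Reasoning
    open +-*-Solver
    w : Fin (suc (suc k)) → ℚ
    w a = x * u a + v a
    minor : SqMatrixℚ (suc k)
    minor r c = A (suc r) (punchIn (suc l) c)
    Dᵤ Dᵥ : ℚ
    Dᵤ = detℚ (λ r c → setCol₀ A u (suc r) (punchIn (suc l) c))
    Dᵥ = detℚ (λ r c → setCol₀ A v (suc r) (punchIn (suc l) c))

detℚ-setCol₀-0 : ∀ {k} (A : SqMatrixℚ (suc k)) → detℚ (setCol₀ A (λ _ → 0ℚ)) ≡ 0ℚ
detℚ-setCol₀-0 A = trans (detℚ-setCol₀-linear A (- 1ℚ) (λ _ → 0ℚ) (λ _ → 0ℚ))
  (solve 1 (λ d → con (- 1ℚ) :* d :+ d := con 0ℚ) refl (detℚ (setCol₀ A (λ _ → 0ℚ))))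
  where open +-*-Solver

detℚ-setCol₀-sum : ∀ {k s} (A : SqMatrixℚ (suc k)) (w : Fin s → ℚ) (G : Fin (suc k) → Fin s → ℚ) →
  detℚ (setCol₀ A (λ a → sumℚ (λ j → w j * G a j))) ≡ sumℚ (λ j → w j * detℚ (setCol₀ A (λ a → G a j)))
detℚ-setCol₀-sum {s = zero}  A w G = detℚ-setCol₀-0 A
detℚ-setCol₀-sum {s = suc s} A w G = trans
  (detℚ-setCol₀-linear A (w zero) (λ a → G a zero) (λ a → sumℚ (λ j → w (suc j) * G a (suc j))))
  (cong (w zero * detℚ (setCol₀ A (λ a → G a zero)) +_) (detℚ-setCol₀-sum A (w ∘ suc) (λ a → G a ∘ suc)))

-- Expanding the first column of A along a kernel vector u: u₀ · det A is a sum of determinants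
-- with a repeated column, while the combination itself is the zero column.
detℚ-kernel : ∀ {k} (A : SqMatrixℚ (suc k)) (u : Fin (suc k) → ℚ) → u zero ≢ 0ℚ →
  (∀ a → sumℚ (λ b → A a b * u b) ≡ 0ℚ) → detℚ A ≡ 0ℚ
detℚ-kernel {k} A u u₀≢0 Au≡0 = p*q≡0⇒q≡0 u₀≢0 (begin
  u zero * detℚ A                                                        ≡⟨ ℚP.+-identityʳ _ ⟨
  u zero * detℚ A + 0ℚ                                                   ≡⟨ cong₂ _+_ (cong (u zero *_) (detℚ-cong column₀)) (sym (repeated k A u)) ⟩
  sumℚ (λ j → u j * detℚ (setCol₀ A (λ a → A a j)))                      ≡⟨ detℚ-setCol₀-sum A u A ⟨
  detℚ (setCol₀ A (λ a → sumℚ (λ j → u j * A a j)))                      ≡⟨ detℚ-cong combination ⟩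
  detℚ (setCol₀ A (λ _ → 0ℚ))                                            ≡⟨ detℚ-setCol₀-0 A ⟩
  0ℚ                                                                     ∎)
  where
  open ≡-Reasoning
  column₀ : ∀ a b → A a b ≡ setCol₀ A (λ a → A a zero) a b
  column₀ a zero    = refl
  column₀ a (suc b) = refl
  combination : ∀ a b → setCol₀ A (λ a → sumℚ (λ j → u j * A a j)) a b ≡ setCol₀ A (λ _ → 0ℚ) a b
  combination a zero    = trans (sumℚ-cong (λ j → ℚP.*-comm (u j) (A a j))) (Au≡0 a)
  combination a (suc b) = refl
  repeated : ∀ k (A : SqMatrixℚ (suc k)) (u : Fin (suc k) → ℚ) → sumℚ (λ j → u (suc j) * detℚ (setCol₀ A (λ a → A a (suc j)))) ≡ 0ℚ
  repeated zero    A u = refl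
  repeated (suc k) A u = trans
    (sumℚ-cong (λ j → trans (cong (u (suc j) *_) (detℚ-equal-columns j (setCol₀ A (λ a → A a (suc j))) (λ a → refl)))
                            (ℚP.*-zeroʳ (u (suc j)))))
    (sumℚ-0 {suc k})

-- Signs and supports

Is0±1 : ℤ → Set
Is0±1 a = (a ≡ ℤ.0ℤ) ⊎ (a ≡ ℤ.1ℤ) ⊎ (a ≡ ℤ.-1ℤ)

Is0±1-neg : ∀ {a} → Is0±1 a → Is0±1 (ℤ.- a)
Is0±1-neg (inj₁ refl)        = inj₁ refl
Is0±1-neg (inj₂ (inj₁ refl)) = inj₂ (inj₂ refl)
Is0±1-neg (inj₂ (inj₂ refl)) = inj₂ (inj₁ refl)

Is0±1-altSign : ∀ {k} (j : Fin k) {d} → Is0±1 d → Is0±1 (altSign j ℤ.* d)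
Is0±1-altSign zero    {d} d∈ = subst Is0±1 (sym (ℤP.*-identityˡ d)) d∈
Is0±1-altSign (suc j) {d} d∈ = subst Is0±1 (ℤP.neg-distribˡ-* (altSign j) d) (Is0±1-neg (Is0±1-altSign j d∈))

SameSign : ℚ → ℚ → Set
SameSign p q = (0ℚ < p × 0ℚ < q) ⊎ (p < 0ℚ × q < 0ℚ)

sgn : ℚ → ℤ
sgn p with ℚP.<-cmp p 0ℚ
... | tri< _ _ _ = ℤ.-1ℤ
... | tri≈ _ _ _ = ℤ.0ℤ
... | tri> _ _ _ = ℤ.1ℤ

sgn-Is0±1 : ∀ p → Is0±1 (sgn p)
sgn-Is0±1 p with ℚP.<-cmp p 0ℚ
... | tri< _ _ _ = inj₂ (inj₂ refl)
... | tri≈ _ _ _ = inj₁ refl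
... | tri> _ _ _ = inj₂ (inj₁ refl)

sgn≡0⇒p≡0 : ∀ {p} → sgn p ≡ ℤ.0ℤ → p ≡ 0ℚ
sgn≡0⇒p≡0 {p} with ℚP.<-cmp p 0ℚ
... | tri≈ _ p≡0 _ = λ _ → p≡0

p≡0⇒sgn≡0 : ∀ {p} → p ≡ 0ℚ → sgn p ≡ ℤ.0ℤ
p≡0⇒sgn≡0 refl = refl

sgn-SameSign : ∀ {p} → p ≢ 0ℚ → SameSign (toQ (sgn p)) p
sgn-SameSign {p} p≢0 with ℚP.<-cmp p 0ℚ
... | tri< p<0 _ _ = inj₂ (from-yes (toQ ℤ.-1ℤ ℚP.<? 0ℚ) , p<0)
... | tri≈ _ p≡0 _ = ⊥-elim (p≢0 p≡0)
... | tri> _ _ p>0 = inj₁ (from-yes (0ℚ ℚP.<? toQ ℤ.1ℤ) , p>0)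

sgn-neg : ∀ p → sgn (- p) ≡ ℤ.- sgn p
sgn-neg p with ℚP.<-cmp p 0ℚ | ℚP.<-cmp (- p) 0ℚ
... | tri< _ _ _   | tri> _ _ _   = refl
... | tri≈ _ _ _   | tri≈ _ _ _   = refl
... | tri> _ _ _   | tri< _ _ _   = refl
... | tri< p<0 _ _ | tri< -p<0 _ _ = ⊥-elim (ℚP.<-asym (ℚP.neg-antimono-< p<0) -p<0)
... | tri< p<0 _ _ | tri≈ _ -p≡0 _ = ⊥-elim (ℚP.<-irrefl (sym -p≡0) (ℚP.neg-antimono-< p<0))
... | tri≈ _ refl _ | tri< -p<0 _ _ = ⊥-elim (ℚP.<-irrefl refl -p<0)
... | tri≈ _ refl _ | tri> _ _ -p>0 = ⊥-elim (ℚP.<-irrefl refl -p>0)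
... | tri> _ _ p>0 | tri≈ _ -p≡0 _ = ⊥-elim (ℚP.<-irrefl -p≡0 (ℚP.neg-antimono-< p>0))
... | tri> _ _ p>0 | tri> _ _ -p>0 = ⊥-elim (ℚP.<-asym (ℚP.neg-antimono-< p>0) -p>0)

toQ-square-±1 : ∀ {a} → Is0±1 a → a ≢ ℤ.0ℤ → toQ a * toQ a ≡ 1ℚ
toQ-square-±1 (inj₁ refl)        a≢0 = ⊥-elim (a≢0 refl)
toQ-square-±1 (inj₂ (inj₁ refl)) _   = refl
toQ-square-±1 (inj₂ (inj₂ refl)) _   = refl

toQ-sgn-* : ∀ c {a} → Is0±1 a → toQ (sgn (c * toQ a)) ≡ toQ (sgn c) * toQ a
toQ-sgn-* c (inj₁ refl) = trans (cong (toQ ∘ sgn) (ℚP.*-zeroʳ c)) (sym (ℚP.*-zeroʳ (toQ (sgn c))))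
toQ-sgn-* c (inj₂ (inj₁ refl)) = trans (cong (toQ ∘ sgn) (ℚP.*-identityʳ c)) (sym (ℚP.*-identityʳ (toQ (sgn c))))
toQ-sgn-* c (inj₂ (inj₂ refl)) = begin
  toQ (sgn (c * toQ ℤ.-1ℤ)) ≡⟨ cong (toQ ∘ sgn) (solve 1 (λ x → x :* con (- 1ℚ) := :- x) refl c) ⟩
  toQ (sgn (- c))           ≡⟨ cong toQ (sgn-neg c) ⟩
  toQ (ℤ.- sgn c)           ≡⟨ toQ-neg (sgn c) ⟩
  - toQ (sgn c)             ≡⟨ solve 1 (λ x → :- x := x :* con (- 1ℚ)) refl (toQ (sgn c)) ⟩
  toQ (sgn c) * toQ ℤ.-1ℤ  ∎
  where open ≡-Reasoning
        open +-*-Solver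

record Enumeration {n} (P : Fin n → Set) : Set where
  field
    size      : ℕ
    elem      : Fin size → Fin n
    injective : Injective _≡_ _≡_ elem
    elem-∈    : ∀ j → P (elem j)
    onto      : ∀ e → P e → ∃ λ j → elem j ≡ e

enumerate : ∀ {n} {P : Fin n → Set} → (∀ e → Dec (P e)) → Enumeration P
enumerate {zero} P? = record { size = 0 ; elem = λ () ; injective = λ {} ; elem-∈ = λ () ; onto = λ () }
enumerate {suc n} {P} P? with enumerate (P? ∘ suc) | P? zero
... | E | no ¬P0 = record
  { size = size ; elem = suc ∘ elem ; injective = injective ∘ FinP.suc-injective ; elem-∈ = elem-∈
  ; onto = λ { zero P0 → ⊥-elim (¬P0 P0) ; (suc e) Pe → let j , eq = onto e Pe in j , cong suc eq } }
  where open Enumeration E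
... | E | yes P0 = record
  { size = suc size ; elem = zero ∷ᵥ (suc ∘ elem) ; injective = inj ; elem-∈ = λ { zero → P0 ; (suc j) → elem-∈ j }
  ; onto = λ { zero _ → zero , refl ; (suc e) Pe → let j , eq = onto e Pe in suc j , cong suc eq } }
  where
  open Enumeration E
  inj : Injective _≡_ _≡_ (zero ∷ᵥ (suc ∘ elem))
  inj {zero}  {zero}  _  = refl
  inj {suc i} {suc j} eq = cong suc (injective (FinP.suc-injective eq))

scatter : ∀ {k n} → (Fin k → Fin n) → (Fin k → ℚ) → Fin n → ℚ
scatter C w e = sumℚ (λ j → δ (C j) e * w j)

scatter-outside : ∀ {k n} (C : Fin k → Fin n) (w : Fin k → ℚ) {e} → (∀ j → C j ≢ e) → scatter C w e ≡ 0ℚ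
scatter-outside {k} C w C≢e = trans (sumℚ-cong (λ j → trans (cong (_* w j) (δ-≢ (C≢e j))) (ℚP.*-zeroˡ (w j)))) (sumℚ-0 {k})

scatter-at : ∀ {k n} {C : Fin k → Fin n} → Injective _≡_ _≡_ C → (w : Fin k → ℚ) → ∀ i → scatter C w (C i) ≡ w i
scatter-at {C = C} C-inj w i = trans (sumℚ-cong (λ j → cong (_* w j) (trans (δ-C j) (δ-sym j i)))) (sumℚ-δ i w)
  where
  δ-C : ∀ j → δ (C j) (C i) ≡ δ j i
  δ-C j with j Fin.≟ i
  ... | yes refl = δ-refl (C j)
  ... | no  j≢i  = δ-≢ (j≢i ∘ C-inj)

sumℚ-*-scatter : ∀ {k n} (C : Fin k → Fin n) (w : Fin k → ℚ) (g : Fin n → ℚ) →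
  sumℚ (λ e → g e * scatter C w e) ≡ sumℚ (λ j → g (C j) * w j)
sumℚ-*-scatter C w g = begin
  sumℚ (λ e → g e * sumℚ (λ j → δ (C j) e * w j))   ≡⟨ sumℚ-cong (λ e → sym (sumℚ-*ˡ (g e) (λ j → δ (C j) e * w j))) ⟩
  sumℚ (λ e → sumℚ (λ j → g e * (δ (C j) e * w j))) ≡⟨ sumℚ-comm (λ e j → g e * (δ (C j) e * w j)) ⟩
  sumℚ (λ j → sumℚ (λ e → g e * (δ (C j) e * w j))) ≡⟨ sumℚ-cong (λ j → sumℚ-cong (λ e → reorder (g e) (δ (C j) e) (w j))) ⟩
  sumℚ (λ j → sumℚ (λ e → δ (C j) e * (g e * w j))) ≡⟨ sumℚ-cong (λ j → sumℚ-δ (C j) (λ e → g e * w j)) ⟩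
  sumℚ (λ j → g (C j) * w j)                        ∎
  where
  open ≡-Reasoning
  reorder : ∀ a b c → a * (b * c) ≡ b * (a * c)
  reorder = solve 3 (λ a b c → a :* (b :* c) := b :* (a :* c)) refl
    where open +-*-Solver

scatter-Is0±1 : ∀ {k n} {D : Fin k → Fin n} → Injective _≡_ _≡_ D → (a : Fin k → ℤ) → (∀ j → Is0±1 (a j)) →
  ∀ e → ∃ λ b → Is0±1 b × scatter D (toQ ∘ a) e ≡ toQ b
scatter-Is0±1 {D = D} D-injective a a∈ e with FinP.any? (λ j → D j Fin.≟ e)
... | yes (j , refl) = a j , a∈ j , scatter-at D-injective (toQ ∘ a) j
... | no  ∄j         = ℤ.0ℤ , inj₁ refl , scatter-outside D (toQ ∘ a) (λ j Dj≡e → ∄j (j , Dj≡e))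

scatter-restrict : ∀ {k n} {D : Fin k → Fin n} → Injective _≡_ _≡_ D → (y : QVec n) →
  (∀ j → y (D j) ≢ 0ℚ) → (∀ e → y e ≢ 0ℚ → ∃ λ j → D j ≡ e) → ∀ e → scatter D (y ∘ D) e ≡ y e
scatter-restrict {D = D} D-injective y D⊆y y⊆D e with y e ℚ.≟ 0ℚ
... | yes ye≡0 = trans (scatter-outside D (y ∘ D) (λ j Dj≡e → D⊆y j (trans (cong y Dj≡e) ye≡0))) (sym ye≡0)
... | no  ye≢0 with y⊆D e ye≢0
...   | j , refl = scatter-at D-injective (y ∘ D) j

record SupportListing {n} (y : QVec n) (e₀ : Fin n) : Set where
  field
    size      : ℕ
    rest      : Fin size → Fin n
    injective : Injective _≡_ _≡_ (e₀ ∷ᵥ rest)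
    listed    : ∀ j → y ((e₀ ∷ᵥ rest) j) ≢ 0ℚ
    complete  : ∀ e → y e ≢ 0ℚ → ∃ λ j → (e₀ ∷ᵥ rest) j ≡ e

list-support : ∀ {n} (y : QVec n) {e₀} → y e₀ ≢ 0ℚ → SupportListing y e₀
list-support y {e₀} y₀≢0 = record { size = size ; rest = elem ; injective = inj ; listed = listed ; complete = complete }
  where
  open Enumeration (enumerate {P = λ e → y e ≢ 0ℚ × e ≢ e₀} (λ e → ¬? (y e ℚ.≟ 0ℚ) ×-dec ¬? (e Fin.≟ e₀)))
  inj : Injective _≡_ _≡_ (e₀ ∷ᵥ elem)
  inj {zero}  {zero}  _     = refl
  inj {zero}  {suc j} e₀≡ej = ⊥-elim (proj₂ (elem-∈ j) (sym e₀≡ej))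
  inj {suc i} {zero}  ei≡e₀ = ⊥-elim (proj₂ (elem-∈ i) ei≡e₀)
  inj {suc i} {suc j} ei≡ej = cong suc (injective ei≡ej)
  listed : ∀ j → y ((e₀ ∷ᵥ elem) j) ≢ 0ℚ
  listed zero    = y₀≢0
  listed (suc j) = proj₁ (elem-∈ j)
  complete : ∀ e → y e ≢ 0ℚ → ∃ λ j → (e₀ ∷ᵥ elem) j ≡ e
  complete e ye≢0 with e Fin.≟ e₀
  ... | yes refl = zero , refl
  ... | no  e≢e₀ = let j , ej≡e = onto e (ye≢0 , e≢e₀) in suc j , ej≡e

-- Minimal-support kernel vectors of a totally unimodular matrix

module _ {m n : ℕ} (M : Matrix m n) where

  InF-cong : ∀ {y v : QVec n} → (∀ e → y e ≡ v e) → InF M y → InF M v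
  InF-cong y≗v My≡0 i = trans (sumℚ-cong (λ e → cong (toQ (M i e) *_) (sym (y≗v e)))) (My≡0 i)

  InF-lin : ∀ a b {y v : QVec n} → InF M y → InF M v → InF M (λ e → a * y e + b * v e)
  InF-lin a b {y} {v} My≡0 Mv≡0 i = begin
    sumℚ (λ e → Mᵢ e * (a * y e + b * v e))               ≡⟨ sumℚ-cong (λ e → distrib (Mᵢ e) (y e) (v e)) ⟩
    sumℚ (λ e → a * (Mᵢ e * y e) + b * (Mᵢ e * v e))      ≡⟨ sumℚ-+ (λ e → a * (Mᵢ e * y e)) (λ e → b * (Mᵢ e * v e)) ⟩
    sumℚ (λ e → a * (Mᵢ e * y e)) + sumℚ (λ e → b * (Mᵢ e * v e))
                                                          ≡⟨ cong₂ _+_ (sumℚ-*ˡ a (λ e → Mᵢ e * y e)) (sumℚ-*ˡ b (λ e → Mᵢ e * v e)) ⟩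
    a * sumℚ (λ e → Mᵢ e * y e) + b * sumℚ (λ e → Mᵢ e * v e) ≡⟨ cong₂ (λ p q → a * p + b * q) (My≡0 i) (Mv≡0 i) ⟩
    a * 0ℚ + b * 0ℚ                                       ≡⟨ cong₂ _+_ (ℚP.*-zeroʳ a) (ℚP.*-zeroʳ b) ⟩
    0ℚ                                                    ∎
    where
    open ≡-Reasoning
    Mᵢ : Fin n → ℚ
    Mᵢ e = toQ (M i e)
    distrib : ∀ m y v → m * (a * y + b * v) ≡ a * (m * y) + b * (m * v)
    distrib m y v = solve 5 (λ a b m y v → m :* (a :* y :+ b :* v) := a :* (m :* y) :+ b :* (m :* v)) refl a b m y v
      where open +-*-Solver

  InF-scale : ∀ a {y : QVec n} → InF M y → InF M (λ e → a * y e)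
  InF-scale a {y} My≡0 = InF-cong (λ e → trans (cong (a * y e +_) (ℚP.*-zeroˡ (y e))) (ℚP.+-identityʳ (a * y e)))
                                  (InF-lin a 0ℚ My≡0 My≡0)

  cofactor : ∀ {k} → (Fin k → Fin m) → (Fin (suc k) → Fin n) → Fin (suc k) → ℤ
  cofactor R D j = altSign j ℤ.* det (λ a b → M (R a) (D (punchIn j b)))

  row·cofactor : ∀ {k} i (R : Fin k → Fin m) (D : Fin (suc k) → Fin n) →
    sumℚ (λ j → toQ (M i (D j)) * toQ (cofactor R D j)) ≡ toQ (det (λ a b → M ((i ∷ᵥ R) a) (D b)))
  row·cofactor i R D = sym (trans (toQ-sumℤ (λ j → altSign j ℤ.* M i (D j) ℤ.* det (λ a b → M (R a) (D (punchIn j b))))) (sumℚ-cong λ j → trans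
    (cong toQ (solve 3 (λ s x d → s :* x :* d := x :* (s :* d)) refl (altSign j) (M i (D j)) (det (λ a b → M (R a) (D (punchIn j b))))))
    (toQ-* (M i (D j)) (cofactor R D j))))
    where open ℤSolver.+-*-Solver

  LinearlyIndependent : ∀ {k} → (Fin k → Fin n) → Set
  LinearlyIndependent {k} C = ∀ (w : Fin k → ℚ) → (∀ i → sumℚ (λ j → toQ (M i (C j)) * w j) ≡ 0ℚ) → ∀ j → w j ≡ 0ℚ

  LinearlyIndependent-tail : ∀ {k} (C : Fin (suc k) → Fin n) → LinearlyIndependent C → LinearlyIndependent (C ∘ suc)
  LinearlyIndependent-tail C ind w Cw≡0 j = ind (0ℚ ∷ᵥ w) C[0∷w]≡0 (suc j)
    where
    C[0∷w]≡0 : ∀ i → toQ (M i (C zero)) * 0ℚ + sumℚ (λ j → toQ (M i (C (suc j))) * w j) ≡ 0ℚ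
    C[0∷w]≡0 i = trans (cong₂ _+_ (ℚP.*-zeroʳ (toQ (M i (C zero)))) refl) (trans (ℚP.+-identityˡ _) (Cw≡0 i))

  -- If no row extends R to a nonsingular minor, the cofactor vector of R would be a dependency.
  independent⇒nonsingular : ∀ {k} (C : Fin k → Fin n) → LinearlyIndependent C →
    ∃ λ (R : Fin k → Fin m) → det (λ a b → M (R a) (C b)) ≢ ℤ.0ℤ
  independent⇒nonsingular {zero} C ind = (λ ()) , λ ()
  independent⇒nonsingular {suc k} C ind
    with independent⇒nonsingular (C ∘ suc) (LinearlyIndependent-tail C ind)
  ... | R , det≢0 with FinP.any? (λ r → ¬? (det (λ a b → M ((r ∷ᵥ R) a) (C b)) ℤ.≟ ℤ.0ℤ))
  ...   | yes (r , det′≢0) = r ∷ᵥ R , det′≢0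
  ...   | no ¬∃r = ⊥-elim (det≢0 (toQ-injective (trans (cong toQ (sym (ℤP.*-identityˡ (det (λ a b → M (R a) (C (suc b))))))) (ind w Cw≡0 zero))))
    where
    w : Fin (suc k) → ℚ
    w = toQ ∘ cofactor R C
    Cw≡0 : ∀ i → sumℚ (λ j → toQ (M i (C j)) * w j) ≡ 0ℚ
    Cw≡0 i = trans (row·cofactor i R C) (cong toQ (decidable-stable (_ ℤ.≟ _) λ det≢0 → ¬∃r (i , det≢0)))

  MinimalSupport : QVec n → Set
  MinimalSupport y = ∀ z → InF M z → (∀ e → y e ≡ 0ℚ → z e ≡ 0ℚ) → (∃ λ e → y e ≢ 0ℚ × z e ≡ 0ℚ) → ∀ e → z e ≡ 0ℚ

  minimal⇒proportional : ∀ {y v : QVec n} → InF M y → MinimalSupport y → InF M v → (∀ e → y e ≡ 0ℚ → v e ≡ 0ℚ) →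
    ∀ {e₀} → y e₀ ≢ 0ℚ → ∀ e → v e₀ * y e ≡ y e₀ * v e
  minimal⇒proportional {y} {v} My≡0 min Mv≡0 v⊆y {e₀} y₀≢0 e =
    x∙y⁻¹≈ε⇒x≈y _ _ (trans (cong (v e₀ * y e +_) (ℚP.neg-distribˡ-* (y e₀) (v e))) (min z Mz≡0 z⊆y (e₀ , y₀≢0 , z₀≡0) e))
    where
    open +-*-Solver
    z : QVec n
    z e = v e₀ * y e + (- y e₀) * v e
    Mz≡0 : InF M z
    Mz≡0 = InF-lin (v e₀) (- y e₀) My≡0 Mv≡0
    z⊆y : ∀ e → y e ≡ 0ℚ → z e ≡ 0ℚ
    z⊆y e ye≡0 rewrite ye≡0 | v⊆y e ye≡0 = solve 2 (λ a b → a :* con 0ℚ :+ b :* con 0ℚ := con 0ℚ) refl (v e₀) (- y e₀)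
    z₀≡0 : z e₀ ≡ 0ℚ
    z₀≡0 = solve 2 (λ a b → a :* b :+ (:- b) :* a := con 0ℚ) refl (v e₀) (y e₀)

  minimal⇒independent : ∀ {y : QVec n} → MinimalSupport y → ∀ {e₀} → y e₀ ≢ 0ℚ →
    ∀ {k} {C : Fin k → Fin n} → Injective _≡_ _≡_ C → (∀ j → y (C j) ≢ 0ℚ × C j ≢ e₀) → LinearlyIndependent C
  minimal⇒independent {y} min {e₀} y₀≢0 {C = C} C-injective C⊆ w Cw≡0 j =
    trans (sym (scatter-at C-injective w j)) (min z Mz≡0 z⊆y (e₀ , y₀≢0 , z₀≡0) (C j))
    where
    z : QVec n
    z = scatter C w
    Mz≡0 : InF M z
    Mz≡0 i = trans (sumℚ-*-scatter C w (toQ ∘ M i)) (Cw≡0 i)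
    z⊆y : ∀ e → y e ≡ 0ℚ → z e ≡ 0ℚ
    z⊆y e ye≡0 = scatter-outside C w (λ j Cj≡e → proj₁ (C⊆ j) (trans (cong y Cj≡e) ye≡0))
    z₀≡0 : z e₀ ≡ 0ℚ
    z₀≡0 = scatter-outside C w (proj₂ ∘ C⊆)

  cofactor-Is0±1 : TotallyUnimodular M → ∀ {k} (R : Fin k → Fin m) D j → Is0±1 (cofactor R D j)
  cofactor-Is0±1 TU R D j = Is0±1-altSign j (TU _ R (D ∘ punchIn j))

  -- Each row i, put on top of R, gives a square matrix with the kernel vector u, so its
  -- determinant, which is the product of row i with the cofactor vector, vanishes.
  cofactor-kernel : ∀ {k} (R : Fin k → Fin m) (D : Fin (suc k) → Fin n) (u : Fin (suc k) → ℚ) → u zero ≢ 0ℚ →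
    (∀ i → sumℚ (λ j → toQ (M i (D j)) * u j) ≡ 0ℚ) →
    ∀ i → sumℚ (λ j → toQ (M i (D j)) * toQ (cofactor R D j)) ≡ 0ℚ
  cofactor-kernel R D u u₀≢0 Du≡0 i = begin
    sumℚ (λ j → toQ (M i (D j)) * toQ (cofactor R D j)) ≡⟨ row·cofactor i R D ⟩
    toQ (det (λ a b → M ((i ∷ᵥ R) a) (D b)))            ≡⟨ toQ-det (λ a b → M ((i ∷ᵥ R) a) (D b)) ⟩
    detℚ (λ a b → toQ (M ((i ∷ᵥ R) a) (D b)))           ≡⟨ detℚ-kernel (λ a b → toQ (M ((i ∷ᵥ R) a) (D b))) u u₀≢0 (Du≡0 ∘ (i ∷ᵥ R)) ⟩
    0ℚ                                                  ∎
    where open ≡-Reasoning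

  -- A minimal-support kernel vector y is a multiple of the extension by zero v of a cofactor vector,
  -- whose entries lie in {0, ±1} by total unimodularity; so sgn ∘ y = sgn c · v is in the kernel.
  minimal⇒sgn-in-kernel : TotallyUnimodular M → ∀ {y : QVec n} → InF M y → MinimalSupport y →
    ∀ {e₀} → y e₀ ≢ 0ℚ → InF M (toQVec (sgn ∘ y))
  minimal⇒sgn-in-kernel TU {y} My≡0 min {e₀} y₀≢0 = InF-cong sgn-y (InF-scale (toQ (sgn c)) Mv≡0)
    where
    open SupportListing (list-support y y₀≢0)
    D : Fin (suc size) → Fin n
    D = e₀ ∷ᵥ rest
    nonsingular : ∃ λ (R : Fin size → Fin m) → det (λ a b → M (R a) (rest b)) ≢ ℤ.0ℤ
    nonsingular = independent⇒nonsingular rest (minimal⇒independent min y₀≢0 (FinP.suc-injective ∘ injective)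
      λ j → listed (suc j) , λ restj≡e₀ → FinP.0≢1+n (sym (injective restj≡e₀)))
    R : Fin size → Fin m
    R = proj₁ nonsingular
    v : QVec n
    v = scatter D (toQ ∘ cofactor R D)
    Mv≡0 : InF M v
    Mv≡0 i = trans (sumℚ-*-scatter D (toQ ∘ cofactor R D) (toQ ∘ M i))
      (cofactor-kernel R D (y ∘ D) y₀≢0 (λ i → trans (sym (sumℚ-*-scatter D (y ∘ D) (toQ ∘ M i)))
        (trans (sumℚ-cong (λ e → cong (toQ (M i e) *_) (scatter-restrict injective y listed complete e))) (My≡0 i))) i)
    v⊆y : ∀ e → y e ≡ 0ℚ → v e ≡ 0ℚ
    v⊆y e ye≡0 = scatter-outside D (toQ ∘ cofactor R D) (λ j Dj≡e → listed j (trans (cong y Dj≡e) ye≡0))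
    v₀² : v e₀ * v e₀ ≡ 1ℚ
    v₀² = trans (cong (λ x → x * x) v₀≡d) (toQ-square-±1 (TU size R rest) (proj₂ nonsingular))
      where
      v₀≡d : v e₀ ≡ toQ (det (λ a b → M (R a) (rest b)))
      v₀≡d = trans (scatter-at injective (toQ ∘ cofactor R D) zero) (cong toQ (ℤP.*-identityˡ (det (λ a b → M (R a) (rest b)))))
    c : ℚ
    c = v e₀ * y e₀
    y≡cv : ∀ e → y e ≡ c * v e
    y≡cv e = begin
      y e                 ≡⟨ ℚP.*-identityˡ (y e) ⟨
      1ℚ * y e            ≡⟨ cong (_* y e) v₀² ⟨
      v e₀ * v e₀ * y e   ≡⟨ ℚP.*-assoc (v e₀) (v e₀) (y e) ⟩
      v e₀ * (v e₀ * y e) ≡⟨ cong (v e₀ *_) (minimal⇒proportional My≡0 min Mv≡0 v⊆y y₀≢0 e) ⟩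
      v e₀ * (y e₀ * v e) ≡⟨ ℚP.*-assoc (v e₀) (y e₀) (v e) ⟨
      c * v e             ∎
      where open ≡-Reasoning
    sgn-y : ∀ e → toQ (sgn c) * v e ≡ toQ (sgn (y e))
    sgn-y e = let b , b∈ , ve≡b = scatter-Is0±1 injective (cofactor R D) (cofactor-Is0±1 TU R D) e in begin
      toQ (sgn c) * v e     ≡⟨ cong (toQ (sgn c) *_) ve≡b ⟩
      toQ (sgn c) * toQ b   ≡⟨ toQ-sgn-* c b∈ ⟨
      toQ (sgn (c * toQ b)) ≡⟨ cong (λ x → toQ (sgn (c * x))) ve≡b ⟨
      toQ (sgn (c * v e))   ≡⟨ cong (toQ ∘ sgn) (y≡cv e) ⟨
      toQ (sgn (y e))       ∎
      where open ≡-Reasoning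

  minimal⇒sgn-circuit : TotallyUnimodular M → ∀ {y : QVec n} → InF M y → MinimalSupport y →
    ∀ {e₀} → y e₀ ≢ 0ℚ → IsCircuit M (sgn ∘ y)
  minimal⇒sgn-circuit TU {y} My≡0 min {e₀} y₀≢0 =
    sgn-Is0±1 ∘ y , (e₀ , y₀≢0 ∘ sgn≡0⇒p≡0) , minimal⇒sgn-in-kernel TU My≡0 min y₀≢0 ,
    λ z Mz≡0 z⊆ (e , sgn≢0 , ze≡0) → min z Mz≡0 (λ e → z⊆ e ∘ p≡0⇒sgn≡0) (e , sgn≢0 ∘ p≡0⇒sgn≡0 , ze≡0)

-- Conformal decomposition

SameSign-trans : ∀ {p q r} → SameSign p q → SameSign q r → SameSign p r
SameSign-trans (inj₁ (p>0 , _))   (inj₁ (_ , r>0))   = inj₁ (p>0 , r>0)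
SameSign-trans (inj₁ (_ , q>0))   (inj₂ (q<0 , _))   = ⊥-elim (ℚP.<-asym q>0 q<0)
SameSign-trans (inj₂ (_ , q<0))   (inj₁ (q>0 , _))   = ⊥-elim (ℚP.<-asym q>0 q<0)
SameSign-trans (inj₂ (p<0 , _))   (inj₂ (_ , r<0))   = inj₂ (p<0 , r<0)

SameSign-sym : ∀ {p q} → SameSign p q → SameSign q p
SameSign-sym (inj₁ (p>0 , q>0)) = inj₁ (q>0 , p>0)
SameSign-sym (inj₂ (p<0 , q<0)) = inj₂ (q<0 , p<0)

SameSign-refl : ∀ {p} → p ≢ 0ℚ → SameSign p p
SameSign-refl {p} p≢0 with ℚP.<-cmp p 0ℚ
... | tri< p<0 _ _   = inj₂ (p<0 , p<0)
... | tri≈ _ p≡0 _   = ⊥-elim (p≢0 p≡0)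
... | tri> _ _ p>0   = inj₁ (p>0 , p>0)

SameSign⇒≢0 : ∀ {p q} → SameSign p q → p ≢ 0ℚ
SameSign⇒≢0 (inj₁ (p>0 , _)) p≡0 = ℚP.<-irrefl (sym p≡0) p>0
SameSign⇒≢0 (inj₂ (p<0 , _)) p≡0 = ℚP.<-irrefl p≡0 p<0

*-pos⇒SameSign : ∀ p q → 0ℚ < p * q → SameSign p q
*-pos⇒SameSign p q pq>0 with ℚP.<-cmp p 0ℚ | ℚP.<-cmp q 0ℚ
... | tri< p<0 _ _ | tri< q<0 _ _ = inj₂ (p<0 , q<0)
... | tri> _ _ p>0 | tri> _ _ q>0 = inj₁ (p>0 , q>0)
... | tri≈ _ refl _ | _           = ⊥-elim (ℚP.<-irrefl (sym (ℚP.*-zeroˡ q)) pq>0)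
... | _ | tri≈ _ refl _           = ⊥-elim (ℚP.<-irrefl (sym (ℚP.*-zeroʳ p)) pq>0)
... | tri< p<0 _ _ | tri> _ _ q>0 = ⊥-elim (ℚP.<-asym pq>0 (ℚP.negative⁻¹ _ {{ℚP.neg*pos⇒neg p {{ℚ.negative p<0}} q {{ℚ.positive q>0}}}}))
... | tri> _ _ p>0 | tri< q<0 _ _ = ⊥-elim (ℚP.<-asym pq>0 (ℚP.negative⁻¹ _ {{ℚP.pos*neg⇒neg p {{ℚ.positive p>0}} q {{ℚ.negative q<0}}}}))

Conformal : ∀ {n} → QVec n → QVec n → Set
Conformal y q = ∀ e → y e ≡ 0ℚ ⊎ SameSign (y e) (q e)

Conformal-refl : ∀ {n} (y : QVec n) → Conformal y y
Conformal-refl y e with y e ℚ.≟ 0ℚ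
... | yes ye≡0 = inj₁ ye≡0
... | no  ye≢0 = inj₂ (SameSign-refl ye≢0)

Conformal-trans : ∀ {n} {y y′ q : QVec n} → Conformal y′ y → Conformal y q → Conformal y′ q
Conformal-trans y′≼y y≼q e with y′≼y e | y≼q e
... | inj₁ y′e≡0 | _          = inj₁ y′e≡0
... | inj₂ y′∼y  | inj₁ ye≡0  = ⊥-elim (SameSign⇒≢0 (SameSign-sym y′∼y) ye≡0)
... | inj₂ y′∼y  | inj₂ y∼q   = inj₂ (SameSign-trans y′∼y y∼q)

Conformal⇒⊆ : ∀ {n} {y′ y : QVec n} → Conformal y′ y → ∀ e → y e ≡ 0ℚ → y′ e ≡ 0ℚ
Conformal⇒⊆ y′≼y e ye≡0 with y′≼y e
... | inj₁ y′e≡0 = y′e≡0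
... | inj₂ y′∼y  = ⊥-elim (SameSign⇒≢0 (SameSign-sym y′∼y) ye≡0)

sgn-Conformal : ∀ {n} (y : QVec n) → Conformal (toQVec (sgn ∘ y)) y
sgn-Conformal y e with y e ℚ.≟ 0ℚ
... | yes ye≡0 = inj₁ (cong toQ (p≡0⇒sgn≡0 ye≡0))
... | no  ye≢0 = inj₂ (sgn-SameSign ye≢0)

support-size : ∀ {n} → QVec n → ℕ
support-size {zero}  y = 0
support-size {suc n} y with y zero ℚ.≟ 0ℚ
... | yes _ = support-size (y ∘ suc)
... | no  _ = suc (support-size (y ∘ suc))

support-size-mono : ∀ {n} (y y′ : QVec n) → (∀ e → y e ≡ 0ℚ → y′ e ≡ 0ℚ) → support-size y′ ℕ.≤ support-size y
support-size-mono {zero}  y y′ y′⊆y = ℕ.z≤n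
support-size-mono {suc n} y y′ y′⊆y with y zero ℚ.≟ 0ℚ | y′ zero ℚ.≟ 0ℚ
... | yes y₀≡0 | no y′₀≢0 = ⊥-elim (y′₀≢0 (y′⊆y zero y₀≡0))
... | yes _    | yes _    = support-size-mono (y ∘ suc) (y′ ∘ suc) (y′⊆y ∘ suc)
... | no  _    | yes _    = ℕP.m≤n⇒m≤1+n (support-size-mono (y ∘ suc) (y′ ∘ suc) (y′⊆y ∘ suc))
... | no  _    | no  _    = ℕ.s≤s (support-size-mono (y ∘ suc) (y′ ∘ suc) (y′⊆y ∘ suc))

support-size-< : ∀ {n} (y y′ : QVec n) → (∀ e → y e ≡ 0ℚ → y′ e ≡ 0ℚ) →
  ∀ {f} → y f ≢ 0ℚ → y′ f ≡ 0ℚ → support-size y′ ℕ.< support-size y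
support-size-< {suc n} y y′ y′⊆y {f} yf≢0 y′f≡0 with y zero ℚ.≟ 0ℚ | y′ zero ℚ.≟ 0ℚ | f
... | yes y₀≡0 | no y′₀≢0 | _     = ⊥-elim (y′₀≢0 (y′⊆y zero y₀≡0))
... | yes y₀≡0 | _        | zero  = ⊥-elim (yf≢0 y₀≡0)
... | no  _    | no y′₀≢0 | zero  = ⊥-elim (y′₀≢0 y′f≡0)
... | no  _    | yes _    | zero  = ℕ.s≤s (support-size-mono (y ∘ suc) (y′ ∘ suc) (y′⊆y ∘ suc))
... | yes _    | yes _    | suc f = support-size-< (y ∘ suc) (y′ ∘ suc) (y′⊆y ∘ suc) yf≢0 y′f≡0
... | no  _    | yes _    | suc f = ℕ.s≤s (ℕP.<⇒≤ (support-size-< (y ∘ suc) (y′ ∘ suc) (y′⊆y ∘ suc) yf≢0 y′f≡0))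
... | no  _    | no  _    | suc f = ℕ.s≤s (support-size-< (y ∘ suc) (y′ ∘ suc) (y′⊆y ∘ suc) yf≢0 y′f≡0)

argmin : ∀ {N} {P : Fin N → Set} → (∀ g → Dec (P g)) → (r : Fin N → ℚ) →
  (∃ λ f → P f × ∀ g → P g → r f ≤ r g) ⊎ (∀ g → ¬ P g)
argmin {zero}  P? r = inj₂ λ ()
argmin {suc N} P? r with argmin (P? ∘ suc) (r ∘ suc) | P? zero
... | inj₂ ∄P | no ¬P₀ = inj₂ λ { zero → ¬P₀ ; (suc g) → ∄P g }
... | inj₂ ∄P | yes P₀ = inj₁ (zero , P₀ , λ { zero _ → ℚP.≤-refl ; (suc g) Pg → ⊥-elim (∄P g Pg) })
... | inj₁ (f , Pf , min) | no ¬P₀ = inj₁ (suc f , Pf , λ { zero P₀ → ⊥-elim (¬P₀ P₀) ; (suc g) Pg → min g Pg })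
... | inj₁ (f , Pf , min) | yes P₀ with r zero ℚP.≤? r (suc f)
...   | yes r₀≤ = inj₁ (zero , P₀ , λ { zero _ → ℚP.≤-refl ; (suc g) Pg → ℚP.≤-trans r₀≤ (min g Pg) })
...   | no  r₀≰ = inj₁ (suc f , Pf , λ { zero _ → ℚP.<⇒≤ (ℚP.≰⇒> r₀≰) ; (suc g) Pg → min g Pg })

-- p (p − t r) = p² − t p r ≥ 0, so p − t r is zero or has the sign of p.
sub-SameSign : ∀ {t p r} → 0ℚ ≤ t → p ≢ 0ℚ → (0ℚ < p * r → t * (p * r) ≤ p * p) → p - t * r ≡ 0ℚ ⊎ SameSign (p - t * r) p
sub-SameSign {t} {p} {r} t≥0 p≢0 bound = by-cases (0≤p⇒p≡0⊎0<p p[p-tr]≥0)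
  where
  tpr≤pp : t * (p * r) ≤ p * p
  tpr≤pp with 0ℚ ℚP.<? p * r
  ... | yes pr>0 = bound pr>0
  ... | no  pr≯0 = ℚP.≤-trans (nonNeg*nonPos t≥0 (ℚP.≮⇒≥ pr≯0)) (0≤p*p p)
  p[p-tr]≥0 : 0ℚ ≤ p * (p - t * r)
  p[p-tr]≥0 = subst (0ℚ ≤_) (solve 3 (λ t p r → p :* p :- t :* (p :* r) := p :* (p :- t :* r)) refl t p r) (p≤q⇒0≤q-p tpr≤pp)
    where open +-*-Solver
  by-cases : p * (p - t * r) ≡ 0ℚ ⊎ 0ℚ < p * (p - t * r) → p - t * r ≡ 0ℚ ⊎ SameSign (p - t * r) p
  by-cases (inj₁ p[p-tr]≡0) = inj₁ (p*q≡0⇒q≡0 p≢0 p[p-tr]≡0)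
  by-cases (inj₂ p[p-tr]>0) = inj₂ (SameSign-sym (*-pos⇒SameSign p (p - t * r) p[p-tr]>0))

module _ {m n : ℕ} (M : Matrix m n) where

  -- y′ = y − t z with t = y f₀ / z f₀ the least ratio y g / z g over coordinates g where y and z
  -- have the same sign: y′ vanishes at f₀ and keeps the signs of y elsewhere.
  eliminate : ∀ {y z : QVec n} → InF M y → InF M z → (∀ e → y e ≡ 0ℚ → z e ≡ 0ℚ) → ∀ {f} → 0ℚ < y f * z f →
    Σ (QVec n) λ y′ → InF M y′ × Conformal y′ y × (∀ e → z e ≡ 0ℚ → y′ e ≡ y e) × (∃ λ f₀ → y f₀ ≢ 0ℚ × y′ f₀ ≡ 0ℚ)
  eliminate {y} {z} My≡0 Mz≡0 z⊆y {f} yz>0 with argmin (λ g → 0ℚ ℚP.<? y g * z g) (λ g → y g * inv (z g))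
  ... | inj₂ ∄g = ⊥-elim (∄g f yz>0)
  ... | inj₁ (f₀ , y₀z₀>0 , t≤) = y′ , My′≡0 , y′≼y , unchanged , (f₀ , y₀≢0 , y′₀≡0)
    where
    open +-*-Solver
    t : ℚ
    t = y f₀ * inv (z f₀)
    y′ : QVec n
    y′ e = y e - t * z e
    z≢0 : ∀ {g} → 0ℚ < y g * z g → z g ≢ 0ℚ
    z≢0 {g} yz>0 = SameSign⇒≢0 (SameSign-sym (*-pos⇒SameSign (y g) (z g) yz>0))
    ratio·yz : ∀ {g} → 0ℚ < y g * z g → y g * inv (z g) * (y g * z g) ≡ y g * y g
    ratio·yz {g} yz>0 = trans (solve 3 (λ y i z → y :* i :* (y :* z) := y :* y :* (z :* i)) refl (y g) (inv (z g)) (z g))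
      (trans (cong (y g * y g *_) (*-inv (z≢0 yz>0))) (ℚP.*-identityʳ (y g * y g)))
    bound : ∀ g → 0ℚ < y g * z g → t * (y g * z g) ≤ y g * y g
    bound g yz>0 = subst (t * (y g * z g) ≤_) (ratio·yz yz>0)
      (ℚP.*-monoʳ-≤-nonNeg (y g * z g) {{ℚ.nonNegative (ℚP.<⇒≤ yz>0)}} (t≤ g yz>0))
    t≥0 : 0ℚ ≤ t
    t≥0 = ℚP.*-cancelʳ-≤-pos (y f₀ * z f₀) {{ℚ.positive y₀z₀>0}}
      (subst₂ _≤_ (sym (ℚP.*-zeroˡ (y f₀ * z f₀))) (sym (ratio·yz y₀z₀>0)) (0≤p*p (y f₀)))
    y₀≢0 : y f₀ ≢ 0ℚ
    y₀≢0 = SameSign⇒≢0 (*-pos⇒SameSign (y f₀) (z f₀) y₀z₀>0)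
    y′₀≡0 : y′ f₀ ≡ 0ℚ
    y′₀≡0 = trans (cong (λ x → y f₀ - x) (trans (solve 3 (λ y i z → y :* i :* z := y :* (z :* i)) refl (y f₀) (inv (z f₀)) (z f₀))
                                         (trans (cong (y f₀ *_) (*-inv (z≢0 y₀z₀>0))) (ℚP.*-identityʳ (y f₀)))))
                  (ℚP.+-inverseʳ (y f₀))
    My′≡0 : InF M y′
    My′≡0 = InF-cong M (λ e → solve 3 (λ t y z → con 1ℚ :* y :+ (:- t) :* z := y :- t :* z) refl t (y e) (z e))
                       (InF-lin M 1ℚ (- t) My≡0 Mz≡0)
    unchanged : ∀ e → z e ≡ 0ℚ → y′ e ≡ y e
    unchanged e ze≡0 = trans (cong (λ x → y e - t * x) ze≡0) (solve 2 (λ t y → y :- t :* con 0ℚ := y) refl t (y e))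
    y′≼y : Conformal y′ y
    y′≼y e with y e ℚ.≟ 0ℚ
    ... | yes ye≡0 = inj₁ (trans (unchanged e (z⊆y e ye≡0)) ye≡0)
    ... | no  ye≢0 = sub-SameSign t≥0 ye≢0 (bound e)

  NonMinimalWitness : QVec n → Set
  NonMinimalWitness y = Σ (QVec n) λ z → InF M z × (∀ e → y e ≡ 0ℚ → z e ≡ 0ℚ) ×
    (∃ λ e → y e ≢ 0ℚ × z e ≡ 0ℚ) × (∃ λ f → z f ≢ 0ℚ)

  ¬minimal⇒witness : ∀ {y} → ¬ MinimalSupport M y → ¬ ¬ NonMinimalWitness y
  ¬minimal⇒witness ¬min ¬witness = ¬min λ z Mz≡0 z⊆y e₁ e →
    decidable-stable (z e ℚ.≟ 0ℚ) λ ze≢0 → ¬witness (z , Mz≡0 , z⊆y , e₁ , e , ze≢0)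

  SmallerConformal : QVec n → Set
  SmallerConformal y = Σ (QVec n) λ y′ → InF M y′ × Conformal y′ y × (∃ λ e → y′ e ≢ 0ℚ) × (∃ λ f → y f ≢ 0ℚ × y′ f ≡ 0ℚ)

  -- Rescaling z by s = y f · z f makes y f · (s z f) = s² positive, as eliminate requires.
  non-minimal⇒smaller : ∀ {y} → InF M y → NonMinimalWitness y → SmallerConformal y
  non-minimal⇒smaller {y} My≡0 (z , Mz≡0 , z⊆y , (e₁ , ye₁≢0 , ze₁≡0) , (f , zf≢0)) =
    let y′ , My′≡0 , y′≼y , unchanged , smaller = eliminate My≡0 (InF-scale M s Mz≡0) sz⊆y s²>0
    in y′ , My′≡0 , y′≼y , (e₁ , λ y′e₁≡0 → ye₁≢0 (trans (sym (unchanged e₁ sze₁≡0)) y′e₁≡0)) , smaller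
    where
    s : ℚ
    s = y f * z f
    s≢0 : s ≢ 0ℚ
    s≢0 s≡0 = zf≢0 (p*q≡0⇒q≡0 (λ yf≡0 → zf≢0 (z⊆y f yf≡0)) s≡0)
    sz⊆y : ∀ e → y e ≡ 0ℚ → s * z e ≡ 0ℚ
    sz⊆y e ye≡0 = trans (cong (s *_) (z⊆y e ye≡0)) (ℚP.*-zeroʳ s)
    sze₁≡0 : s * z e₁ ≡ 0ℚ
    sze₁≡0 = trans (cong (s *_) ze₁≡0) (ℚP.*-zeroʳ s)
    s²>0 : 0ℚ < y f * (s * z f)
    s²>0 with 0≤p⇒p≡0⊎0<p (0≤p*p s)
    ... | inj₁ s²≡0 = ⊥-elim (s≢0 (p*q≡0⇒q≡0 s≢0 s²≡0))
    ... | inj₂ s²>0 = subst (0ℚ <_) (solve 2 (λ y z → (y :* z) :* (y :* z) := y :* ((y :* z) :* z)) refl (y f) (z f)) s²>0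
      where open +-*-Solver

  MinimalConformal : QVec n → Set
  MinimalConformal y = Σ (QVec n) λ y′ → InF M y′ × (∃ λ e → y′ e ≢ 0ℚ) × Conformal y′ y × MinimalSupport M y′

  mutual
    minimal-conformal : ∀ N {y} → support-size y ℕ.≤ N → InF M y → (∃ λ e → y e ≢ 0ℚ) → ¬ ¬ MinimalConformal y
    minimal-conformal N {y} size≤N My≡0 y≢0 = ¬¬-excluded-middle >>= λ
      { (yes min) → return (y , My≡0 , y≢0 , Conformal-refl y , min)
      ; (no ¬min) → ¬minimal⇒witness ¬min >>= λ w → descend N size≤N (non-minimal⇒smaller My≡0 w) }

    descend : ∀ N {y} → support-size y ℕ.≤ N → SmallerConformal y → ¬ ¬ MinimalConformal y
    descend zero {y} size≤0 (y′ , _ , y′≼y , _ , (f , yf≢0 , y′f≡0)) =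
      ⊥-elim (ℕP.n≮0 (ℕP.<-≤-trans (support-size-< y y′ (Conformal⇒⊆ y′≼y) yf≢0 y′f≡0) size≤0))
    descend (suc N) {y} size≤N (y′ , My′≡0 , y′≼y , y′≢0 , (f , yf≢0 , y′f≡0)) =
      minimal-conformal N size′≤N My′≡0 y′≢0 >>= λ (y″ , My″≡0 , y″≢0 , y″≼y′ , min) →
      return (y″ , My″≡0 , y″≢0 , Conformal-trans y″≼y′ y′≼y , min)
      where
      size′≤N : support-size y′ ℕ.≤ N
      size′≤N = ℕP.≤-pred (ℕP.<-≤-trans (support-size-< y y′ (Conformal⇒⊆ y′≼y) yf≢0 y′f≡0) size≤N)

  conformal-circuit : TotallyUnimodular M → ∀ {μ : Fin n → ℤ} → InF M (toQVec μ) → ∀ {e} → μ e ≢ ℤ.0ℤ →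
    ¬ ¬ (Σ (Fin n → ℤ) λ γ → IsCircuit M γ × Conformal (toQVec γ) (toQVec μ))
  conformal-circuit TU {μ} Mμ≡0 {e} μe≢0 =
    minimal-conformal _ ℕP.≤-refl Mμ≡0 (e , μe≢0 ∘ toQ-injective) >>= λ (y , My≡0 , (e₀ , y₀≢0) , y≼μ , min) →
    return (sgn ∘ y , minimal⇒sgn-circuit M TU My≡0 min y₀≢0 , Conformal-trans (sgn-Conformal y) y≼μ)

-- The ℓ¹ norm and the Voronoi cell

2ℚ : ℚ
2ℚ = ℤ.+ 2 ℚ./ 1

_+ᶻ_ _-ᶻ_ : ∀ {n} → (Fin n → ℤ) → (Fin n → ℤ) → Fin n → ℤ
(μ +ᶻ ν) e = μ e ℤ.+ ν e
(μ -ᶻ ν) e = μ e ℤ.- ν e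

0ᶻ : ∀ {n} → Fin n → ℤ
0ᶻ _ = ℤ.0ℤ

‖_‖₁ : ∀ {n} → (Fin n → ℤ) → ℕ
‖ μ ‖₁ = sumℕ (λ e → ℤ.∣ μ e ∣)

ℓ¹ : ∀ {n} → (Fin n → ℤ) → ℚ
ℓ¹ μ = toQ (ℤ.+ ‖ μ ‖₁)

sumℕ-mono-≤ : ∀ {n} {f g : Fin n → ℕ} → (∀ e → f e ℕ.≤ g e) → sumℕ f ℕ.≤ sumℕ g
sumℕ-mono-≤ {zero}  f≤g = ℕ.z≤n
sumℕ-mono-≤ {suc n} f≤g = ℕP.+-mono-≤ (f≤g zero) (sumℕ-mono-≤ (f≤g ∘ suc))

sumℕ-≤-each-≡ : ∀ {n} {f g : Fin n → ℕ} → (∀ e → f e ℕ.≤ g e) → sumℕ g ℕ.≤ sumℕ f → ∀ e → f e ≡ g e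
sumℕ-≤-each-≡ {suc n} {f} {g} f≤g Σg≤Σf e with ℕP.m≤n⇒m<n∨m≡n (f≤g zero) | e
... | inj₁ f₀<g₀ | _     = ⊥-elim (ℕP.<⇒≱ (ℕP.+-mono-<-≤ f₀<g₀ (sumℕ-mono-≤ (f≤g ∘ suc))) Σg≤Σf)
... | inj₂ f₀≡g₀ | zero  = f₀≡g₀
... | inj₂ f₀≡g₀ | suc e = sumℕ-≤-each-≡ (f≤g ∘ suc)
  (ℕP.+-cancelˡ-≤ (g zero) _ _ (subst (λ a → g zero ℕ.+ _ ℕ.≤ a ℕ.+ _) f₀≡g₀ Σg≤Σf)) e

term≤sumℕ : ∀ {n} (f : Fin n → ℕ) e → f e ℕ.≤ sumℕ f
term≤sumℕ f zero    = ℕP.m≤m+n (f zero) _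
term≤sumℕ f (suc e) = ℕP.≤-trans (term≤sumℕ (f ∘ suc) e) (ℕP.m≤n+m _ (f zero))

toQ-sumℕ : ∀ {n} (f : Fin n → ℕ) → toQ (ℤ.+ sumℕ f) ≡ sumℚ (λ e → toQ (ℤ.+ f e))
toQ-sumℕ {zero}  f = refl
toQ-sumℕ {suc n} f = trans (toQ-+ (ℤ.+ f zero) (ℤ.+ sumℕ (f ∘ suc))) (cong (toQ (ℤ.+ f zero) +_) (toQ-sumℕ (f ∘ suc)))

‖‖₁+‖‖₁ : ∀ {n} (μ ν : Fin n → ℤ) → ‖ μ ‖₁ ℕ.+ ‖ ν ‖₁ ≡ sumℕ (λ e → ℤ.∣ μ e ∣ ℕ.+ ℤ.∣ ν e ∣)
‖‖₁+‖‖₁ μ ν = sym (∑-distrib-+ (λ e → ℤ.∣ μ e ∣) (λ e → ℤ.∣ ν e ∣))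

‖‖₁-triangle : ∀ {n} (μ ν : Fin n → ℤ) → ‖ μ +ᶻ ν ‖₁ ℕ.≤ ‖ μ ‖₁ ℕ.+ ‖ ν ‖₁
‖‖₁-triangle μ ν =
  subst (‖ μ +ᶻ ν ‖₁ ℕ.≤_) (sym (‖‖₁+‖‖₁ μ ν)) (sumℕ-mono-≤ (λ e → ℤP.∣i+j∣≤∣i∣+∣j∣ (μ e) (ν e)))

‖‖₁≡0 : ∀ n → ‖ 0ᶻ {n} ‖₁ ≡ 0
‖‖₁≡0 zero    = refl
‖‖₁≡0 (suc n) = ‖‖₁≡0 n

‖‖₁-nonzero : ∀ {n} (μ : Fin n → ℤ) {e} → μ e ≢ ℤ.0ℤ → 1 ℕ.≤ ‖ μ ‖₁
‖‖₁-nonzero μ {e} μe≢0 = ℕP.≤-trans (ℕP.n≢0⇒n>0 (μe≢0 ∘ ℤP.∣i∣≡0⇒i≡0)) (term≤sumℕ (λ e → ℤ.∣ μ e ∣) e)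

ℓ¹≤‖‖² : ∀ {n} (μ : Fin n → ℤ) → ℓ¹ μ ≤ ‖ toQVec μ ‖²
ℓ¹≤‖‖² μ = subst (_≤ ‖ toQVec μ ‖²) (sym (toQ-sumℕ (λ e → ℤ.∣ μ e ∣))) (sumℚ-mono-≤ (λ e → ∣a∣≤a² (μ e)))
  where
  ∣a∣≤a² : ∀ a → toQ (ℤ.+ ℤ.∣ a ∣) ≤ toQ a * toQ a
  ∣a∣≤a² a = subst (toQ (ℤ.+ ℤ.∣ a ∣) ≤_) (toQ-* a a) (toQ-mono-≤ (lemma a))
    where
    lemma : ∀ a → ℤ.+ ℤ.∣ a ∣ ℤ.≤ a ℤ.* a
    lemma (ℤ.+ zero)    = ℤ.+≤+ ℕ.z≤n
    lemma (ℤ.+ (suc k)) = ℤ.+≤+ (ℕP.m≤m*n (suc k) (suc k))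
    lemma -[1+ k ]      = ℤ.+≤+ (ℕP.m≤m*n (suc k) (suc k))

‖‖²≡ℓ¹ : ∀ {n} (γ : Fin n → ℤ) → (∀ e → Is0±1 (γ e)) → ‖ toQVec γ ‖² ≡ ℓ¹ γ
‖‖²≡ℓ¹ γ γ∈ = sym (trans (toQ-sumℕ (λ e → ℤ.∣ γ e ∣)) (sumℚ-cong (λ e → ∣a∣≡a² (γ∈ e))))
  where
  ∣a∣≡a² : ∀ {a} → Is0±1 a → toQ (ℤ.+ ℤ.∣ a ∣) ≡ toQ a * toQ a
  ∣a∣≡a² (inj₁ refl)        = refl
  ∣a∣≡a² (inj₂ (inj₁ refl)) = refl
  ∣a∣≡a² (inj₂ (inj₂ refl)) = refl

-- b lies on the segment from 0 to a
Between : ℤ → ℤ → Set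
Between b a = ℤ.∣ a ∣ ≡ ℤ.∣ b ∣ ℕ.+ ℤ.∣ a ℤ.- b ∣

Between-0 : ∀ a → Between ℤ.0ℤ a
Between-0 a = cong ℤ.∣_∣ (sym (ℤP.+-identityʳ a))

Between-+ʳ : ∀ b c → ℤ.∣ b ℤ.+ c ∣ ≡ ℤ.∣ b ∣ ℕ.+ ℤ.∣ c ∣ → Between b (b ℤ.+ c)
Between-+ʳ b c ∣b+c∣≡ = trans ∣b+c∣≡ (cong (λ x → ℤ.∣ b ∣ ℕ.+ ℤ.∣ x ∣) (solve 2 (λ b c → c := (b :+ c) :- b) refl b c))
  where open ℤSolver.+-*-Solver

Between-+ˡ : ∀ b a d → Between b a → ℤ.∣ d ℤ.+ a ∣ ≡ ℤ.∣ d ∣ ℕ.+ ℤ.∣ a ∣ → Between b (d ℤ.+ a)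
Between-+ˡ b a d b∈[0,a] ∣d+a∣≡ = ℕP.≤-antisym
  (subst (λ x → ℤ.∣ x ∣ ℕ.≤ ℤ.∣ b ∣ ℕ.+ ℤ.∣ d ℤ.+ a ℤ.- b ∣) (solve 3 (λ d a b → b :+ (d :+ a :- b) := d :+ a) refl d a b)
         (ℤP.∣i+j∣≤∣i∣+∣j∣ b (d ℤ.+ a ℤ.- b)))
  (begin
    ℤ.∣ b ∣ ℕ.+ ℤ.∣ d ℤ.+ a ℤ.- b ∣       ≤⟨ ℕP.+-monoʳ-≤ ℤ.∣ b ∣ (subst (λ x → ℤ.∣ x ∣ ℕ.≤ ℤ.∣ d ∣ ℕ.+ ℤ.∣ a ℤ.- b ∣) (solve 3 (λ d a b → d :+ (a :- b) := d :+ a :- b) refl d a b)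
                                                                          (ℤP.∣i+j∣≤∣i∣+∣j∣ d (a ℤ.- b))) ⟩
    ℤ.∣ b ∣ ℕ.+ (ℤ.∣ d ∣ ℕ.+ ℤ.∣ a ℤ.- b ∣) ≡⟨ ℕP.+-comm ℤ.∣ b ∣ (ℤ.∣ d ∣ ℕ.+ ℤ.∣ a ℤ.- b ∣) ⟩
    ℤ.∣ d ∣ ℕ.+ ℤ.∣ a ℤ.- b ∣ ℕ.+ ℤ.∣ b ∣   ≡⟨ ℕP.+-assoc ℤ.∣ d ∣ ℤ.∣ a ℤ.- b ∣ ℤ.∣ b ∣ ⟩
    ℤ.∣ d ∣ ℕ.+ (ℤ.∣ a ℤ.- b ∣ ℕ.+ ℤ.∣ b ∣) ≡⟨ cong (ℤ.∣ d ∣ ℕ.+_) (trans (ℕP.+-comm ℤ.∣ a ℤ.- b ∣ ℤ.∣ b ∣) (sym b∈[0,a])) ⟩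
    ℤ.∣ d ∣ ℕ.+ ℤ.∣ a ∣                     ≡⟨ ∣d+a∣≡ ⟨
    ℤ.∣ d ℤ.+ a ∣                           ∎)
  where
  open ℤSolver.+-*-Solver
  open ℕP.≤-Reasoning

sign-Between : ∀ {g u} → Is0±1 g → toQ g ≡ 0ℚ ⊎ SameSign (toQ g) (toQ u) → Between g u
sign-Between {u = u} (inj₁ refl) _ = Between-0 u
sign-Between {u = u} (inj₂ (inj₁ refl)) (inj₂ (inj₁ (_ , u>0))) = positive (toQ-cancel-< {ℤ.0ℤ} {u} u>0)
  where
  positive : ∀ {u} → ℤ.0ℤ ℤ.< u → ℤ.∣ u ∣ ≡ 1 ℕ.+ ℤ.∣ u ℤ.- ℤ.1ℤ ∣
  positive {ℤ.+ suc k} _ = refl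
  positive {ℤ.+ zero} (ℤ.+<+ ())
sign-Between {u = u} (inj₂ (inj₂ refl)) (inj₂ (inj₂ (_ , u<0))) = negative (toQ-cancel-< {u} {ℤ.0ℤ} u<0)
  where
  negative : ∀ {u} → u ℤ.< ℤ.0ℤ → ℤ.∣ u ∣ ≡ 1 ℕ.+ ℤ.∣ u ℤ.- ℤ.-1ℤ ∣
  negative { -[1+ zero ] } _  = refl
  negative { -[1+ suc k ] } _ = refl
  negative {ℤ.+ k} (ℤ.+<+ ())
sign-Between (inj₂ (inj₁ refl)) (inj₂ (inj₂ (1<0 , _))) = ⊥-elim (ℚP.<-asym 1<0 (from-yes (0ℚ ℚP.<? 1ℚ)))
sign-Between (inj₂ (inj₂ refl)) (inj₂ (inj₁ (-1>0 , _))) = ⊥-elim (ℚP.<-asym -1>0 (from-yes (toQ ℤ.-1ℤ ℚP.<? 0ℚ)))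
sign-Between (inj₂ (inj₁ refl)) (inj₁ ())
sign-Between (inj₂ (inj₂ refl)) (inj₁ ())

⟨⟩-cong : ∀ {n} (x : QVec n) {v w : QVec n} → (∀ e → v e ≡ w e) → ⟨ x , v ⟩ ≡ ⟨ x , w ⟩
⟨⟩-cong x v≗w = sumℚ-cong (λ e → cong (x e *_) (v≗w e))

⟨⟩-+ᶻ : ∀ {n} (x : QVec n) (μ ν : Fin n → ℤ) → ⟨ x , toQVec (μ +ᶻ ν) ⟩ ≡ ⟨ x , toQVec μ ⟩ + ⟨ x , toQVec ν ⟩
⟨⟩-+ᶻ x μ ν = trans (sumℚ-cong (λ e → trans (cong (x e *_) (toQ-+ (μ e) (ν e))) (ℚP.*-distribˡ-+ (x e) (toQ (μ e)) (toQ (ν e)))))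
  (sumℚ-+ (λ e → x e * toQ (μ e)) (λ e → x e * toQ (ν e)))

⟨⟩-split : ∀ {n} (x : QVec n) (μ γ : Fin n → ℤ) → ⟨ x , toQVec μ ⟩ ≡ ⟨ x , toQVec γ ⟩ + ⟨ x , toQVec (μ -ᶻ γ) ⟩
⟨⟩-split x μ γ = trans (⟨⟩-cong x λ e → cong toQ (solve 2 (λ m g → m := g :+ (m :- g)) refl (μ e) (γ e))) (⟨⟩-+ᶻ x γ (μ -ᶻ γ))
  where open ℤSolver.+-*-Solver

⟨⟩-0ᶻ : ∀ {n} (x : QVec n) → ⟨ x , toQVec 0ᶻ ⟩ ≡ 0ℚ
⟨⟩-0ᶻ {n} x = trans (sumℚ-cong (λ e → ℚP.*-zeroʳ (x e))) (sumℚ-0 {n})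

‖-‖²-expand : ∀ {n} (x v : QVec n) → ‖ x -ᵥ v ‖² ≡ ‖ x ‖² - 2ℚ * ⟨ x , v ⟩ + ‖ v ‖²
‖-‖²-expand x v = begin
  sumℚ (λ e → (x e - v e) * (x e - v e))                              ≡⟨ sumℚ-cong (λ e → expand (x e) (v e)) ⟩
  sumℚ (λ e → x e * x e + (- 2ℚ) * (x e * v e) + v e * v e)           ≡⟨ sumℚ-+ _ (λ e → v e * v e) ⟩
  sumℚ (λ e → x e * x e + (- 2ℚ) * (x e * v e)) + ‖ v ‖²              ≡⟨ cong (_+ ‖ v ‖²) (sumℚ-+ (λ e → x e * x e) _) ⟩
  ‖ x ‖² + sumℚ (λ e → (- 2ℚ) * (x e * v e)) + ‖ v ‖²                 ≡⟨ cong (λ s → ‖ x ‖² + s + ‖ v ‖²) (sumℚ-*ˡ (- 2ℚ) (λ e → x e * v e)) ⟩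
  ‖ x ‖² + (- 2ℚ) * ⟨ x , v ⟩ + ‖ v ‖²                                ≡⟨ cong (λ s → ‖ x ‖² + s + ‖ v ‖²) (ℚP.neg-distribˡ-* 2ℚ ⟨ x , v ⟩) ⟨
  ‖ x ‖² - 2ℚ * ⟨ x , v ⟩ + ‖ v ‖²                                    ∎
  where
  open ≡-Reasoning
  expand : ∀ a b → (a - b) * (a - b) ≡ a * a + (- 2ℚ) * (a * b) + b * b
  expand = solve 2 (λ a b → (a :- b) :* (a :- b) := a :* a :+ (:- con 2ℚ) :* (a :* b) :+ b :* b) refl
    where open +-*-Solver

closer⇔half-space : ∀ {n} (x v : QVec n) → ‖ x ‖² ≤ ‖ x -ᵥ v ‖² ⇔ 2ℚ * ⟨ x , v ⟩ ≤ ‖ v ‖²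
closer⇔half-space x v = mk⇔
  (λ le → 0≤q-p⇒p≤q (subst (0ℚ ≤_) (rearrange ‖ x ‖² (2ℚ * ⟨ x , v ⟩) ‖ v ‖²)
                      (p≤q⇒0≤q-p (subst (‖ x ‖² ≤_) (‖-‖²-expand x v) le))))
  (λ le → subst (‖ x ‖² ≤_) (sym (‖-‖²-expand x v))
    (0≤q-p⇒p≤q (subst (0ℚ ≤_) (sym (rearrange ‖ x ‖² (2ℚ * ⟨ x , v ⟩) ‖ v ‖²)) (p≤q⇒0≤q-p le))))
  where
  rearrange : ∀ a b c → a - b + c - a ≡ c - b
  rearrange = solve 3 (λ a b c → a :- b :+ c :- a := c :- b) refl
    where open +-*-Solver

2⟨⟩-split : ∀ {n} (x : QVec n) (μ γ : Fin n → ℤ) →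
  2ℚ * ⟨ x , toQVec μ ⟩ ≡ 2ℚ * ⟨ x , toQVec γ ⟩ + 2ℚ * ⟨ x , toQVec (μ -ᶻ γ) ⟩
2⟨⟩-split x μ γ = trans (cong (2ℚ *_) (⟨⟩-split x μ γ)) (ℚP.*-distribˡ-+ 2ℚ ⟨ x , toQVec γ ⟩ ⟨ x , toQVec (μ -ᶻ γ) ⟩)

ℓ¹-split : ∀ {n} (μ γ : Fin n → ℤ) → ‖ μ ‖₁ ≡ ‖ γ ‖₁ ℕ.+ ‖ μ -ᶻ γ ‖₁ → ℓ¹ μ ≡ ℓ¹ γ + ℓ¹ (μ -ᶻ γ)
ℓ¹-split μ γ split = trans (cong (toQ ∘ ℤ.+_) split) (toQ-+ (ℤ.+ ‖ γ ‖₁) (ℤ.+ ‖ μ -ᶻ γ ‖₁))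

ℓ¹-nonNeg : ∀ {n} (μ : Fin n → ℤ) → 0ℚ ≤ ℓ¹ μ
ℓ¹-nonNeg μ = toQ-mono-≤ {ℤ.0ℤ} {ℤ.+ ‖ μ ‖₁} (ℤ.+≤+ ℕ.z≤n)

module _ {m n : ℕ} (M : Matrix m n) where

  InF-+ᶻ : ∀ {μ ν : Fin n → ℤ} → InF M (toQVec μ) → InF M (toQVec ν) → InF M (toQVec (μ +ᶻ ν))
  InF-+ᶻ {μ} {ν} Mμ≡0 Mν≡0 = InF-cong M
    (λ e → trans (solve 2 (λ a b → con 1ℚ :* a :+ con 1ℚ :* b := a :+ b) refl (toQ (μ e)) (toQ (ν e))) (sym (toQ-+ (μ e) (ν e))))
    (InF-lin M 1ℚ 1ℚ Mμ≡0 Mν≡0)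
    where open +-*-Solver

  InF--ᶻ : ∀ {μ ν : Fin n → ℤ} → InF M (toQVec μ) → InF M (toQVec ν) → InF M (toQVec (μ -ᶻ ν))
  InF--ᶻ {μ} {ν} Mμ≡0 Mν≡0 = InF-cong M
    (λ e → trans (solve 2 (λ a b → con 1ℚ :* a :+ con (- 1ℚ) :* b := a :- b) refl (toQ (μ e)) (toQ (ν e)))
                 (sym (trans (toQ-+ (μ e) (ℤ.- ν e)) (cong (toQ (μ e) +_) (toQ-neg (ν e))))))
    (InF-lin M 1ℚ (- 1ℚ) Mμ≡0 Mν≡0)
    where open +-*-Solver

  InF-0ᶻ : InF M (toQVec 0ᶻ)
  InF-0ᶻ i = trans (sumℚ-cong (λ e → ℚP.*-zeroʳ (toQ (M i e)))) (sumℚ-0 {n})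

  conformal-circuit-split : ∀ {γ μ : Fin n → ℤ} → IsCircuit M γ → Conformal (toQVec γ) (toQVec μ) →
    ‖ μ ‖₁ ≡ ‖ γ ‖₁ ℕ.+ ‖ μ -ᶻ γ ‖₁
  conformal-circuit-split {γ} {μ} (γ∈ , _) γ≼μ =
    trans (sum-cong-≗ (λ e → sign-Between {u = μ e} (γ∈ e) (γ≼μ e))) (∑-distrib-+ (λ e → ℤ.∣ γ e ∣) (λ e → ℤ.∣ μ e ℤ.- γ e ∣))

  CircuitBounds : QVec n → Set
  CircuitBounds x = ∀ γ → IsCircuit M γ → 2ℚ * ⟨ x , toQVec γ ⟩ ≤ ‖ toQVec γ ‖²

  LatticeBounds : QVec n → Set
  LatticeBounds x = ∀ μ → InF M (toQVec μ) → 2ℚ * ⟨ x , toQVec μ ⟩ ≤ ℓ¹ μ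

  -- Induction on ‖ μ ‖₁, peeling off a circuit conformal to μ.
  circuit-bounds⇒lattice-bounds : TotallyUnimodular M → ∀ {x} → CircuitBounds x → LatticeBounds x
  circuit-bounds⇒lattice-bounds TU {x} bounds μ Mμ≡0 = decidable-stable (_ ℚP.≤? _) (bound ‖ μ ‖₁ μ ℕP.≤-refl Mμ≡0)
    where
    Bound : (Fin n → ℤ) → Set
    Bound μ = 2ℚ * ⟨ x , toQVec μ ⟩ ≤ ℓ¹ μ
    mutual
      bound : ∀ N μ → ‖ μ ‖₁ ℕ.≤ N → InF M (toQVec μ) → ¬ ¬ Bound μ
      bound N μ ‖μ‖≤N Mμ≡0 with FinP.any? (λ e → ¬? (μ e ℤ.≟ ℤ.0ℤ))
      ... | no ∄e = return (subst (_≤ ℓ¹ μ) (sym 2⟨x,μ⟩≡0) (ℓ¹-nonNeg μ))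
        where
        2⟨x,μ⟩≡0 : 2ℚ * ⟨ x , toQVec μ ⟩ ≡ 0ℚ
        2⟨x,μ⟩≡0 = trans (cong (2ℚ *_) (trans (⟨⟩-cong x (λ e → cong toQ (decidable-stable (μ e ℤ.≟ ℤ.0ℤ) (λ μe≢0 → ∄e (e , μe≢0)))))
                                               (⟨⟩-0ᶻ x)))
                         (ℚP.*-zeroʳ 2ℚ)
      ... | yes (e , μe≢0) = conformal-circuit M TU {μ} Mμ≡0 μe≢0 >>= λ (γ , γ-circuit , γ≼μ) →
        peel N μ ‖μ‖≤N Mμ≡0 γ-circuit (conformal-circuit-split {γ} {μ} γ-circuit γ≼μ)

      peel : ∀ N μ → ‖ μ ‖₁ ℕ.≤ N → InF M (toQVec μ) →
        ∀ {γ} → IsCircuit M γ → ‖ μ ‖₁ ≡ ‖ γ ‖₁ ℕ.+ ‖ μ -ᶻ γ ‖₁ → ¬ ¬ Bound μ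
      peel N μ ‖μ‖≤N Mμ≡0 {γ} γ-circuit@(γ∈ , (e , γe≢0) , Mγ≡0 , _) split
        with N | ℕP.≤-trans (ℕP.+-monoˡ-≤ ‖ μ -ᶻ γ ‖₁ (‖‖₁-nonzero γ γe≢0)) (subst (ℕ._≤ N) split ‖μ‖≤N)
      ... | zero  | ()
      ... | suc N | ℕ.s≤s ‖μ-γ‖≤N = bound N (μ -ᶻ γ) ‖μ-γ‖≤N (InF--ᶻ {μ} {γ} Mμ≡0 Mγ≡0) >>= λ bound-μ-γ → return
        (subst₂ _≤_ (sym (2⟨⟩-split x μ γ)) (sym (ℓ¹-split μ γ split))
          (ℚP.+-mono-≤ (subst (2ℚ * ⟨ x , toQVec γ ⟩ ≤_) (‖‖²≡ℓ¹ γ γ∈) (bounds γ γ-circuit)) bound-μ-γ))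

  V₀⇒circuit-bounds : ∀ {x} → InV0 M x → CircuitBounds x
  V₀⇒circuit-bounds {x} (_ , closer) γ (_ , _ , Mγ≡0 , _) = Equivalence.to (closer⇔half-space x (toQVec γ)) (closer γ Mγ≡0)

  V₀⇒lattice-bounds : TotallyUnimodular M → ∀ {x} → InV0 M x → LatticeBounds x
  V₀⇒lattice-bounds TU {x} x∈V₀ = circuit-bounds⇒lattice-bounds TU {x} (V₀⇒circuit-bounds {x} x∈V₀)

  circuit-bounds⇒V₀ : TotallyUnimodular M → ∀ {x} → InF M x → CircuitBounds x → InV0 M x
  circuit-bounds⇒V₀ TU {x} Mx≡0 bounds = Mx≡0 , λ μ Mμ≡0 →
    Equivalence.from (closer⇔half-space x (toQVec μ)) (ℚP.≤-trans (circuit-bounds⇒lattice-bounds TU {x} bounds μ Mμ≡0) (ℓ¹≤‖‖² μ))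

  Tight : QVec n → (Fin n → ℤ) → Set
  Tight x μ = 2ℚ * ⟨ x , toQVec μ ⟩ ≡ ℓ¹ μ

  -- 2⟨x, μ + ν⟩ = ‖μ‖₁ + ‖ν‖₁ ≥ ‖μ + ν‖₁ ≥ 2⟨x, μ + ν⟩ forces equality, also coordinatewise.
  tight-+ : TotallyUnimodular M → ∀ {x} → InV0 M x → ∀ {μ ν} → InF M (toQVec μ) → InF M (toQVec ν) → Tight x μ → Tight x ν →
    Tight x (μ +ᶻ ν) × (∀ f → ℤ.∣ μ f ℤ.+ ν f ∣ ≡ ℤ.∣ μ f ∣ ℕ.+ ℤ.∣ ν f ∣)
  tight-+ TU {x} x∈V₀ {μ} {ν} Mμ≡0 Mν≡0 μ-tight ν-tight =
    trans 2⟨x,μ+ν⟩≡ (cong (toQ ∘ ℤ.+_) (ℕP.≤-antisym ≤‖μ+ν‖₁ (‖‖₁-triangle μ ν))) ,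
    sumℕ-≤-each-≡ (λ f → ℤP.∣i+j∣≤∣i∣+∣j∣ (μ f) (ν f)) (subst (ℕ._≤ ‖ μ +ᶻ ν ‖₁) (‖‖₁+‖‖₁ μ ν) ≤‖μ+ν‖₁)
    where
    2⟨x,μ+ν⟩≡ : 2ℚ * ⟨ x , toQVec (μ +ᶻ ν) ⟩ ≡ toQ (ℤ.+ (‖ μ ‖₁ ℕ.+ ‖ ν ‖₁))
    2⟨x,μ+ν⟩≡ = begin
      2ℚ * ⟨ x , toQVec (μ +ᶻ ν) ⟩                       ≡⟨ cong (2ℚ *_) (⟨⟩-+ᶻ x μ ν) ⟩
      2ℚ * (⟨ x , toQVec μ ⟩ + ⟨ x , toQVec ν ⟩)          ≡⟨ ℚP.*-distribˡ-+ 2ℚ ⟨ x , toQVec μ ⟩ ⟨ x , toQVec ν ⟩ ⟩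
      2ℚ * ⟨ x , toQVec μ ⟩ + 2ℚ * ⟨ x , toQVec ν ⟩      ≡⟨ cong₂ _+_ μ-tight ν-tight ⟩
      ℓ¹ μ + ℓ¹ ν                                         ≡⟨ toQ-+ (ℤ.+ ‖ μ ‖₁) (ℤ.+ ‖ ν ‖₁) ⟨
      toQ (ℤ.+ (‖ μ ‖₁ ℕ.+ ‖ ν ‖₁))                       ∎
      where open ≡-Reasoning
    ≤‖μ+ν‖₁ : ‖ μ ‖₁ ℕ.+ ‖ ν ‖₁ ℕ.≤ ‖ μ +ᶻ ν ‖₁
    ≤‖μ+ν‖₁ = ℤP.drop‿+≤+ (toQ-cancel-≤ (subst (_≤ ℓ¹ (μ +ᶻ ν)) 2⟨x,μ+ν⟩≡
      (V₀⇒lattice-bounds TU {x} x∈V₀ (μ +ᶻ ν) (InF-+ᶻ {μ} {ν} Mμ≡0 Mν≡0))))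

-- Circuit hyperplanes through a point of V₀

Σᶻ : ∀ {k n} → (Fin k → Fin n → ℤ) → Fin n → ℤ
Σᶻ {zero}  D = 0ᶻ
Σᶻ {suc k} D = D zero +ᶻ Σᶻ (D ∘ suc)

module _ {m n : ℕ} (M : Matrix m n) where

  tight-0ᶻ : ∀ x → Tight M x 0ᶻ
  tight-0ᶻ x = trans (cong (2ℚ *_) (⟨⟩-0ᶻ x)) (trans (ℚP.*-zeroʳ 2ℚ) (cong (toQ ∘ ℤ.+_) (sym (‖‖₁≡0 n))))

  tight-sum : TotallyUnimodular M → ∀ {x} → InV0 M x → ∀ {k} (D : Fin k → Fin n → ℤ) →
    (∀ j → InF M (toQVec (D j))) → (∀ j → Tight M x (D j)) →
    InF M (toQVec (Σᶻ D)) × Tight M x (Σᶻ D) × (∀ j f → Between (D j f) (Σᶻ D f))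
  tight-sum TU {x} x∈V₀ {zero}  D MD≡0 D-tight = InF-0ᶻ M , tight-0ᶻ x , λ ()
  tight-sum TU {x} x∈V₀ {suc k} D MD≡0 D-tight =
    InF-+ᶻ M {D zero} {Σᶻ (D ∘ suc)} (MD≡0 zero) MS≡0 , proj₁ sum , between
    where
    tail : InF M (toQVec (Σᶻ (D ∘ suc))) × Tight M x (Σᶻ (D ∘ suc)) × (∀ j f → Between (D (suc j) f) (Σᶻ (D ∘ suc) f))
    tail = tight-sum TU x∈V₀ (D ∘ suc) (MD≡0 ∘ suc) (D-tight ∘ suc)
    MS≡0 : InF M (toQVec (Σᶻ (D ∘ suc)))
    MS≡0 = proj₁ tail
    sum : Tight M x (Σᶻ D) × (∀ f → ℤ.∣ D zero f ℤ.+ Σᶻ (D ∘ suc) f ∣ ≡ ℤ.∣ D zero f ∣ ℕ.+ ℤ.∣ Σᶻ (D ∘ suc) f ∣)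
    sum = tight-+ M TU x∈V₀ {D zero} {Σᶻ (D ∘ suc)} (MD≡0 zero) MS≡0 (D-tight zero) (proj₁ (proj₂ tail))
    between : ∀ j f → Between (D j f) (D zero f ℤ.+ Σᶻ (D ∘ suc) f)
    between zero    f = Between-+ʳ (D zero f) (Σᶻ (D ∘ suc) f) (proj₂ sum f)
    between (suc j) f = Between-+ˡ (D (suc j) f) (Σᶻ (D ∘ suc) f) (D zero f) (proj₂ (proj₂ tail) j f) (proj₂ sum f)

  tight-split : TotallyUnimodular M → ∀ {x} → InV0 M x → ∀ {μ γ} → InF M (toQVec μ) → InF M (toQVec γ) →
    Tight M x μ → ‖ μ ‖₁ ≡ ‖ γ ‖₁ ℕ.+ ‖ μ -ᶻ γ ‖₁ → Tight M x γ
  tight-split TU {x} x∈V₀ {μ} {γ} Mμ≡0 Mγ≡0 μ-tight split = +-≤-≡⇒≡ˡ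
    (V₀⇒lattice-bounds M TU {x} x∈V₀ γ Mγ≡0)
    (V₀⇒lattice-bounds M TU {x} x∈V₀ (μ -ᶻ γ) (InF--ᶻ M {μ} {γ} Mμ≡0 Mγ≡0))
    (trans (sym (2⟨⟩-split x μ γ)) (trans μ-tight (ℓ¹-split μ γ split)))

  -- Summing, over the support of γ, circuits through x that agree with γ at one element each gives a
  -- tight vector Γ in which γ lies coordinatewise between 0 and Γ, so γ splits off tightly.
  circuit-hyperplane : TotallyUnimodular M → ∀ {x} → InV0 M x → ∀ {γ} → IsCircuit M γ →
    (∀ e → γ e ≢ ℤ.0ℤ → ∃ λ δ → IsCircuit M δ × OnFγ M δ x × δ e ≡ γ e) → OnFγ M γ x
  circuit-hyperplane TU {x} x∈V₀ {γ} (γ∈ , _ , Mγ≡0 , _) carried = trans γ-tight (sym (‖‖²≡ℓ¹ γ γ∈))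
    where
    Carrier : Fin n → Set
    Carrier e = Σ (Fin n → ℤ) λ δ → InF M (toQVec δ) × Tight M x δ × (γ e ≢ ℤ.0ℤ → δ e ≡ γ e)
    carrier : ∀ e → Carrier e
    carrier e with γ e ℤ.≟ ℤ.0ℤ
    ... | yes γe≡0 = 0ᶻ , InF-0ᶻ M , tight-0ᶻ x , λ γe≢0 → ⊥-elim (γe≢0 γe≡0)
    ... | no  γe≢0 = let δ , (δ∈ , _ , Mδ≡0 , _) , x∈Fδ , δe≡γe = carried e γe≢0
                     in δ , Mδ≡0 , trans x∈Fδ (‖‖²≡ℓ¹ δ δ∈) , λ _ → δe≡γe
    D : Fin n → Fin n → ℤ
    D = proj₁ ∘ carrier
    Γ : Fin n → ℤ
    Γ = Σᶻ D
    Γ-facts : InF M (toQVec Γ) × Tight M x Γ × (∀ j f → Between (D j f) (Γ f))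
    Γ-facts = tight-sum TU x∈V₀ D (proj₁ ∘ proj₂ ∘ carrier) (proj₁ ∘ proj₂ ∘ proj₂ ∘ carrier)
    γ-between : ∀ f → Between (γ f) (Γ f)
    γ-between f with γ f ℤ.≟ ℤ.0ℤ
    ... | yes γf≡0 = subst (λ c → Between c (Γ f)) (sym γf≡0) (Between-0 (Γ f))
    ... | no  γf≢0 = subst (λ c → Between c (Γ f)) (proj₂ (proj₂ (proj₂ (carrier f))) γf≢0) (proj₂ (proj₂ Γ-facts) f f)
    γ-tight : Tight M x γ
    γ-tight = tight-split TU x∈V₀ {Γ} {γ} (proj₁ Γ-facts) Mγ≡0 (proj₁ (proj₂ Γ-facts))
      (trans (sum-cong-≗ γ-between) (∑-distrib-+ (λ f → ℤ.∣ γ f ∣) (λ f → ℤ.∣ Γ f ℤ.- γ f ∣)))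

-- Faces are cut out by circuit hyperplanes

_≗ᶻ_ : ∀ {n} → (Fin n → ℤ) → (Fin n → ℤ) → Set
γ ≗ᶻ γ′ = ∀ e → γ e ≡ γ′ e

signVectors : ∀ n → List (Fin n → ℤ)
signVectors zero    = (λ ()) ∷ []
signVectors (suc n) = map (ℤ.0ℤ ∷ᵥ_) (signVectors n) ++ map (ℤ.1ℤ ∷ᵥ_) (signVectors n) ++ map (ℤ.-1ℤ ∷ᵥ_) (signVectors n)

signVectors-complete : ∀ {n} (γ : Fin n → ℤ) → (∀ e → Is0±1 (γ e)) → Any (γ ≗ᶻ_) (signVectors n)
signVectors-complete {zero}  γ γ∈ = here λ ()
signVectors-complete {suc n} γ γ∈ = by-cases (γ∈ zero)
  where
  L : List (Fin n → ℤ)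
  L = signVectors n
  extend : ∀ {c} {vs : List (Fin n → ℤ)} → γ zero ≡ c → Any ((γ ∘ suc) ≗ᶻ_) vs → Any (λ v → γ ≗ᶻ (c ∷ᵥ v)) vs
  extend γ₀≡c (here γ≗v) = here λ { zero → γ₀≡c ; (suc e) → γ≗v e }
  extend γ₀≡c (there p)  = there (extend γ₀≡c p)
  tail : Any ((γ ∘ suc) ≗ᶻ_) L
  tail = signVectors-complete (γ ∘ suc) (γ∈ ∘ suc)
  by-cases : Is0±1 (γ zero) → Any (γ ≗ᶻ_) (signVectors (suc n))
  by-cases (inj₁ γ₀≡0)        = AnyP.++⁺ˡ (AnyP.map⁺ (extend γ₀≡0 tail))
  by-cases (inj₂ (inj₁ γ₀≡1))  = AnyP.++⁺ʳ (map (ℤ.0ℤ ∷ᵥ_) L) (AnyP.++⁺ˡ (AnyP.map⁺ (extend γ₀≡1 tail)))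
  by-cases (inj₂ (inj₂ γ₀≡-1)) = AnyP.++⁺ʳ (map (ℤ.0ℤ ∷ᵥ_) L) (AnyP.++⁺ʳ (map (ℤ.1ℤ ∷ᵥ_) L) (AnyP.map⁺ (extend γ₀≡-1 tail)))

slack : ∀ {n} → QVec n → (Fin n → ℤ) → ℚ
slack x γ = ‖ toQVec γ ‖² - 2ℚ * ⟨ x , toQVec γ ⟩

slack-cong : ∀ {n} (x : QVec n) {γ γ′ : Fin n → ℤ} → γ ≗ᶻ γ′ → slack x γ ≡ slack x γ′
slack-cong x γ≗γ′ = cong₂ (λ a b → a - 2ℚ * b) (sumℚ-cong (λ e → cong (λ c → toQ c * toQ c) (γ≗γ′ e)))
                                              (⟨⟩-cong x (λ e → cong toQ (γ≗γ′ e)))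

affine : ∀ {n} → ℚ → QVec n → QVec n → QVec n
affine a x y e = a * x e + (1ℚ - a) * y e

⟨⟩-affineʳ : ∀ {n} (c : QVec n) a (x y : QVec n) → ⟨ c , affine a x y ⟩ ≡ a * ⟨ c , x ⟩ + (1ℚ - a) * ⟨ c , y ⟩
⟨⟩-affineʳ c a x y = begin
  sumℚ (λ e → c e * (a * x e + (1ℚ - a) * y e))            ≡⟨ sumℚ-cong (λ e → distrib (c e) (x e) (y e)) ⟩
  sumℚ (λ e → a * (c e * x e) + (1ℚ - a) * (c e * y e))    ≡⟨ sumℚ-+ (λ e → a * (c e * x e)) (λ e → (1ℚ - a) * (c e * y e)) ⟩
  sumℚ (λ e → a * (c e * x e)) + sumℚ (λ e → (1ℚ - a) * (c e * y e))
                                                           ≡⟨ cong₂ _+_ (sumℚ-*ˡ a (λ e → c e * x e)) (sumℚ-*ˡ (1ℚ - a) (λ e → c e * y e)) ⟩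
  a * ⟨ c , x ⟩ + (1ℚ - a) * ⟨ c , y ⟩                     ∎
  where
  open ≡-Reasoning
  distrib : ∀ c x y → c * (a * x + (1ℚ - a) * y) ≡ a * (c * x) + (1ℚ - a) * (c * y)
  distrib c x y = solve 4 (λ a c x y → c :* (a :* x :+ (con 1ℚ :- a) :* y) := a :* (c :* x) :+ (con 1ℚ :- a) :* (c :* y)) refl a c x y
    where open +-*-Solver

⟨⟩-affineˡ : ∀ {n} a (x y v : QVec n) → ⟨ affine a x y , v ⟩ ≡ a * ⟨ x , v ⟩ + (1ℚ - a) * ⟨ y , v ⟩
⟨⟩-affineˡ a x y v = trans (⟨⟩-comm (affine a x y) v)
  (trans (⟨⟩-affineʳ v a x y) (cong₂ (λ p q → a * p + (1ℚ - a) * q) (⟨⟩-comm v x) (⟨⟩-comm v y)))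
  where
  ⟨⟩-comm : ∀ {n} (u w : QVec n) → ⟨ u , w ⟩ ≡ ⟨ w , u ⟩
  ⟨⟩-comm u w = sumℚ-cong (λ e → ℚP.*-comm (u e) (w e))

slack-affine : ∀ {n} a (x y : QVec n) γ → slack (affine a x y) γ ≡ a * slack x γ + (1ℚ - a) * slack y γ
slack-affine a x y γ = trans (cong (λ p → ‖ toQVec γ ‖² - 2ℚ * p) (⟨⟩-affineˡ a x y (toQVec γ)))
  (solve 4 (λ a N p q → N :- con 2ℚ :* (a :* p :+ (con 1ℚ :- a) :* q) := a :* (N :- con 2ℚ :* p) :+ (con 1ℚ :- a) :* (N :- con 2ℚ :* q))
         refl a ‖ toQVec γ ‖² ⟨ x , toQVec γ ⟩ ⟨ y , toQVec γ ⟩)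
  where open +-*-Solver

margin : ∀ {A : Set} (s r : A → ℚ) (L : List A) → Σ ℚ λ t → 0ℚ < t × All (λ a → 0ℚ < s a → t * ∣ r a ∣ ≤ s a) L
margin s r [] = 1ℚ , from-yes (0ℚ ℚP.<? 1ℚ) , []
margin s r (a ∷ L) with margin s r L | 0ℚ ℚP.<? s a
... | t , t>0 , ok | no  sa≯0 = t , t>0 , (λ sa>0 → ⊥-elim (sa≯0 sa>0)) ∷ ok
... | t , t>0 , ok | yes sa>0 = t ⊓ u , t⊓u>0 , new ∷ All.map (λ old sb>0 → ℚP.≤-trans (*-monoʳ (ℚP.p⊓q≤p t u)) (old sb>0)) ok
  where
  ρ : ℚ
  ρ = ∣ r a ∣ + 1ℚ
  ρ>0 : 0ℚ < ρ
  ρ>0 = ℚP.≤-<-trans (ℚP.0≤∣p∣ (r a)) (subst (_< ρ) (ℚP.+-identityʳ ∣ r a ∣) (ℚP.+-monoʳ-< ∣ r a ∣ (from-yes (0ℚ ℚP.<? 1ℚ))))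
  u : ℚ
  u = s a * inv ρ
  u>0 : 0ℚ < u
  u>0 = pos*pos sa>0 (0<inv ρ>0)
  t⊓u>0 : 0ℚ < t ⊓ u
  t⊓u>0 with ℚP.⊓-sel t u
  ... | inj₁ t⊓u≡t = subst (0ℚ <_) (sym t⊓u≡t) t>0
  ... | inj₂ t⊓u≡u = subst (0ℚ <_) (sym t⊓u≡u) u>0
  *-monoʳ : ∀ {p q} → p ≤ q → ∀ {b} → p * ∣ r b ∣ ≤ q * ∣ r b ∣
  *-monoʳ p≤q {b} = ℚP.*-monoʳ-≤-nonNeg ∣ r b ∣ {{ℚ.nonNegative (ℚP.0≤∣p∣ (r b))}} p≤q
  new : 0ℚ < s a → t ⊓ u * ∣ r a ∣ ≤ s a
  new _ = begin
    t ⊓ u * ∣ r a ∣        ≤⟨ *-monoʳ (ℚP.p⊓q≤q t u) ⟩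
    u * ∣ r a ∣            ≤⟨ ℚP.*-monoˡ-≤-nonNeg u {{ℚ.nonNegative (ℚP.<⇒≤ u>0)}} (subst (_≤ ρ) (ℚP.+-identityʳ ∣ r a ∣)
                                (ℚP.+-monoʳ-≤ ∣ r a ∣ (from-yes (0ℚ ℚP.≤? 1ℚ)))) ⟩
    u * ρ                  ≡⟨ ℚP.*-assoc (s a) (inv ρ) ρ ⟩
    s a * (inv ρ * ρ)      ≡⟨ cong (s a *_) (trans (ℚP.*-comm (inv ρ) ρ) (*-inv (λ ρ≡0 → ℚP.<-irrefl (sym ρ≡0) ρ>0))) ⟩
    s a * 1ℚ               ≡⟨ ℚP.*-identityʳ (s a) ⟩
    s a                    ∎
    where open ℚP.≤-Reasoning

module _ {m n : ℕ} (M : Matrix m n) where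

  OnFγ⇒slack≡0 : ∀ γ (x : QVec n) → OnFγ M γ x → slack x γ ≡ 0ℚ
  OnFγ⇒slack≡0 γ x x∈Fγ = trans (cong (λ p → ‖ toQVec γ ‖² - p) x∈Fγ) (ℚP.+-inverseʳ ‖ toQVec γ ‖²)

  slack≡0⇒OnFγ : ∀ γ (x : QVec n) → slack x γ ≡ 0ℚ → OnFγ M γ x
  slack≡0⇒OnFγ γ x slack≡0 = sym (x∙y⁻¹≈ε⇒x≈y ‖ toQVec γ ‖² (2ℚ * ⟨ x , toQVec γ ⟩) slack≡0)

  V₀⇒slack-nonNeg : ∀ {x : QVec n} → InV0 M x → ∀ μ → InF M (toQVec μ) → 0ℚ ≤ slack x μ
  V₀⇒slack-nonNeg {x} (_ , closer) μ Mμ≡0 =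
    p≤q⇒0≤q-p {2ℚ * ⟨ x , toQVec μ ⟩} {‖ toQVec μ ‖²} (Equivalence.to (closer⇔half-space x (toQVec μ)) (closer μ Mμ≡0))

  slack-nonNeg⇒bound : ∀ (x : QVec n) γ → 0ℚ ≤ slack x γ → 2ℚ * ⟨ x , toQVec γ ⟩ ≤ ‖ toQVec γ ‖²
  slack-nonNeg⇒bound x γ = 0≤q-p⇒p≤q {2ℚ * ⟨ x , toQVec γ ⟩} {‖ toQVec γ ‖²}

  V₀-convex : ∀ {a} → 0ℚ ≤ a → 0ℚ ≤ 1ℚ - a → ∀ {x y} → InV0 M x → InV0 M y → InV0 M (affine a x y)
  V₀-convex {a} a≥0 1-a≥0 {x} {y} x∈V₀ y∈V₀ = InF-lin M a (1ℚ - a) (proj₁ x∈V₀) (proj₁ y∈V₀) , λ μ Mμ≡0 →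
    Equivalence.from (closer⇔half-space (affine a x y) (toQVec μ)) (slack-nonNeg⇒bound (affine a x y) μ (subst (0ℚ ≤_) (sym (slack-affine a x y μ))
      (ℚP.+-mono-≤ (nonNeg*nonNeg a≥0 (V₀⇒slack-nonNeg x∈V₀ μ Mμ≡0)) (nonNeg*nonNeg 1-a≥0 (V₀⇒slack-nonNeg y∈V₀ μ Mμ≡0)))))

  -- Both slacks are nonnegative and their positive combination vanishes.
  hyperplane-through-segment : ∀ {a} → 0ℚ < a → 0ℚ < 1ℚ - a → ∀ {x y} → InV0 M x → InV0 M y → ∀ {γ} → InF M (toQVec γ) →
    OnFγ M γ (affine a x y) → OnFγ M γ x × OnFγ M γ y
  hyperplane-through-segment {a} a>0 1-a>0 {x} {y} x∈V₀ y∈V₀ {γ} Mγ≡0 on =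
    slack≡0⇒OnFγ γ x (p*q≡0⇒q≡0 (λ a≡0 → ℚP.<-irrefl (sym a≡0) a>0) (sym (+-≤-≡⇒≡ˡ ax≥0 by≥0 (sym as+by≡0)))) ,
    slack≡0⇒OnFγ γ y (p*q≡0⇒q≡0 (λ b≡0 → ℚP.<-irrefl (sym b≡0) 1-a>0)
                   (sym (+-≤-≡⇒≡ˡ by≥0 ax≥0 (sym (trans (ℚP.+-comm ((1ℚ - a) * slack y γ) (a * slack x γ)) as+by≡0)))))
    where
    as+by≡0 : a * slack x γ + (1ℚ - a) * slack y γ ≡ 0ℚ
    as+by≡0 = trans (sym (slack-affine a x y γ)) (OnFγ⇒slack≡0 γ (affine a x y) on)
    ax≥0 : 0ℚ ≤ a * slack x γ
    ax≥0 = nonNeg*nonNeg (ℚP.<⇒≤ a>0) (V₀⇒slack-nonNeg x∈V₀ γ Mγ≡0)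
    by≥0 : 0ℚ ≤ (1ℚ - a) * slack y γ
    by≥0 = nonNeg*nonNeg (ℚP.<⇒≤ 1-a>0) (V₀⇒slack-nonNeg y∈V₀ γ Mγ≡0)

  OnFγ-cong : ∀ {γ γ′} (x : QVec n) → γ ≗ᶻ γ′ → OnFγ M γ x → OnFγ M γ′ x
  OnFγ-cong {γ} {γ′} x γ≗γ′ x∈Fγ = slack≡0⇒OnFγ γ′ x (trans (sym (slack-cong x γ≗γ′)) (OnFγ⇒slack≡0 γ x x∈Fγ))

  Supported : (QVec n → Set) → QVec n → ℚ → Set
  Supported F c h = ∀ x → F x ⇔ (InV0 M x × ⟨ c , x ⟩ ≡ h)

  face-convex : ∀ {F c h} → Supported F c h → ∀ {a} → 0ℚ < a → 0ℚ < 1ℚ - a → ∀ {x y} → F x → F y → F (affine a x y)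
  face-convex {F} {c} {h} F⇔ {a} a>0 1-a>0 {x} {y} x∈F y∈F = Equivalence.from (F⇔ (affine a x y))
    ( V₀-convex (ℚP.<⇒≤ a>0) (ℚP.<⇒≤ 1-a>0) (proj₁ x-facts) (proj₁ y-facts)
    , trans (⟨⟩-affineʳ c a x y) (trans (cong₂ (λ p q → a * p + (1ℚ - a) * q) (proj₂ x-facts) (proj₂ y-facts))
                                        (solve 2 (λ a h → a :* h :+ (con 1ℚ :- a) :* h := h) refl a h)))
    where
    open +-*-Solver
    x-facts : InV0 M x × ⟨ c , x ⟩ ≡ h
    x-facts = Equivalence.to (F⇔ x) x∈F
    y-facts : InV0 M y × ⟨ c , y ⟩ ≡ h
    y-facts = Equivalence.to (F⇔ y) y∈F

  -- Quantifying over all γ ≗ᶻ γ′ stands in for function extensionality.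
  Generic : (QVec n → Set) → QVec n → (Fin n → ℤ) → Set
  Generic F xs γ′ = ∀ γ → γ ≗ᶻ γ′ → IsCircuit M γ → OnFγ M γ xs → U M F γ

  -- Each circuit hyperplane missing some point x′ of F is avoided by moving to the midpoint with x′.
  generic-point : ∀ {F c h} → Supported F c h → ∀ {x₀} → F x₀ → ∀ L → ¬ ¬ (Σ (QVec n) λ xs → F xs × All (Generic F xs) L)
  generic-point {F} {c} {h} F⇔ {x₀} x₀∈F [] = return (x₀ , x₀∈F , [])
  generic-point {F} {c} {h} F⇔ x₀∈F (γ′ ∷ L) =
    generic-point {F} {c} {h} F⇔ x₀∈F L >>= λ (xs , xs∈F , generic) → ¬¬-excluded-middle >>= λ
    { (yes F⊆Fγ) → return (xs , xs∈F , (λ γ γ≗γ′ γ-circuit _ → γ-circuit , F⊆Fγ γ γ≗γ′ γ-circuit) ∷ generic)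
    ; (no F⊈Fγ)  → witness F⊈Fγ >>= λ (γ , γ≗γ′ , γ-circuit , x′ , x′∈F , x′∉Fγ) →
        return (affine ½ xs x′ , face-convex {F} {c} {h} F⇔ ½>0 ½>0 xs∈F x′∈F ,
                (λ γ₂ γ₂≗γ′ (_ , _ , Mγ₂≡0 , _) on → ⊥-elim (x′∉Fγ (OnFγ-cong {γ₂} {γ} x′ (λ e → trans (γ₂≗γ′ e) (sym (γ≗γ′ e)))
                  (proj₂ (through-segment xs∈F x′∈F {γ₂} Mγ₂≡0 on))))) ∷
                All.map (λ generic-δ δ δ≗ δ-circuit@(_ , _ , Mδ≡0 , _) on →
                  generic-δ δ δ≗ δ-circuit (proj₁ (through-segment xs∈F x′∈F {δ} Mδ≡0 on))) generic) }
    where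
    ½>0 : 0ℚ < ½
    ½>0 = from-yes (0ℚ ℚP.<? ½)
    through-segment : ∀ {x y} → F x → F y → ∀ {γ} → InF M (toQVec γ) → OnFγ M γ (affine ½ x y) → OnFγ M γ x × OnFγ M γ y
    through-segment {x} {y} x∈F y∈F {γ} =
      hyperplane-through-segment ½>0 ½>0 (proj₁ (Equivalence.to (F⇔ x) x∈F)) (proj₁ (Equivalence.to (F⇔ y) y∈F)) {γ}
    witness : ¬ (∀ γ → γ ≗ᶻ γ′ → IsCircuit M γ → ∀ x → F x → OnFγ M γ x) →
      ¬ ¬ (Σ (Fin n → ℤ) λ γ → γ ≗ᶻ γ′ × IsCircuit M γ × Σ (QVec n) λ x → F x × ¬ OnFγ M γ x)
    witness F⊈Fγ ∄ = F⊈Fγ λ γ γ≗γ′ γ-circuit x x∈F →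
      decidable-stable (2ℚ * ⟨ x , toQVec γ ⟩ ℚ.≟ ‖ toQVec γ ‖²) λ x∉Fγ → ∄ (γ , γ≗γ′ , γ-circuit , x , x∈F , x∉Fγ)

  -- Moving from a generic point xs of F a little further away from y, along the line through y,
  -- keeps every circuit slack nonnegative: slacks positive at xs dominate, and slacks zero at xs
  -- belong to circuits of 𝒰(F), whose hyperplanes contain y.
  extrapolate-in-V₀ : TotallyUnimodular M → ∀ {F c h} → Supported F c h → ∀ {xs} → F xs → All (Generic F xs) (signVectors n) →
    ∀ {y} → InV0 M y → (∀ γ → U M F γ → OnFγ M γ y) →
    ∀ {t} → 0ℚ < t → All (λ γ′ → 0ℚ < slack xs γ′ → t * ∣ slack y γ′ ∣ ≤ slack xs γ′) (signVectors n) →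
    InV0 M (affine (1ℚ + t) xs y)
  extrapolate-in-V₀ TU {F} F⇔ {xs} xs∈F generic {y} y∈V₀ y-on {t} t>0 margins =
    circuit-bounds⇒V₀ M TU (InF-lin M (1ℚ + t) (1ℚ - (1ℚ + t)) (proj₁ xs∈V₀) (proj₁ y∈V₀)) λ γ γ-circuit →
      slack-nonNeg⇒bound z γ (subst (0ℚ ≤_) (sym (slack-affine (1ℚ + t) xs y γ)) (slack≥0 γ γ-circuit))
    where
    open +-*-Solver
    xs∈V₀ : InV0 M xs
    xs∈V₀ = proj₁ (Equivalence.to (F⇔ xs) xs∈F)
    z : QVec n
    z = affine (1ℚ + t) xs y
    slack≥0 : ∀ γ → IsCircuit M γ → 0ℚ ≤ (1ℚ + t) * slack xs γ + (1ℚ - (1ℚ + t)) * slack y γ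
    slack≥0 γ γ-circuit@(γ∈ , _ , Mγ≡0 , _) with All.lookupAny (All.zip (generic , margins)) (signVectors-complete γ γ∈)
    ... | (generic-γ′ , margin-γ′) , γ≗γ′ with 0ℚ ℚP.<? slack xs (Any.lookup (signVectors-complete γ γ∈))
    ...   | yes S>0 = subst (0ℚ ≤_) (solve 3 (λ t S Y → (S :- t :* Y) :+ t :* S := (con 1ℚ :+ t) :* S :+ (con 1ℚ :- (con 1ℚ :+ t)) :* Y) refl t S Y)
                        (ℚP.+-mono-≤ (p≤q⇒0≤q-p tY≤S) (nonNeg*nonNeg (ℚP.<⇒≤ t>0) S≥0))
      where
      S Y : ℚ
      S = slack xs γ
      Y = slack y γ
      S≥0 : 0ℚ ≤ S
      S≥0 = V₀⇒slack-nonNeg xs∈V₀ γ Mγ≡0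
      tY≤S : t * Y ≤ S
      tY≤S = subst₂ (λ p q → t * p ≤ q)
        (trans (cong ∣_∣ (sym (slack-cong y γ≗γ′))) (ℚP.0≤p⇒∣p∣≡p (V₀⇒slack-nonNeg y∈V₀ γ Mγ≡0)))
        (sym (slack-cong xs γ≗γ′)) (margin-γ′ S>0)
    ...   | no  S≯0 = ℚP.≤-reflexive (sym (begin
      (1ℚ + t) * slack xs γ + (1ℚ - (1ℚ + t)) * slack y γ ≡⟨ cong₂ (λ p q → (1ℚ + t) * p + (1ℚ - (1ℚ + t)) * q) S≡0 Y≡0 ⟩
      (1ℚ + t) * 0ℚ + (1ℚ - (1ℚ + t)) * 0ℚ                ≡⟨ cong₂ _+_ (ℚP.*-zeroʳ (1ℚ + t)) (ℚP.*-zeroʳ (1ℚ - (1ℚ + t))) ⟩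
      0ℚ                                                  ∎))
      where
      open ≡-Reasoning
      S≡0 : slack xs γ ≡ 0ℚ
      S≡0 = ℚP.≤-antisym (subst (_≤ 0ℚ) (sym (slack-cong xs γ≗γ′)) (ℚP.≮⇒≥ S≯0)) (V₀⇒slack-nonNeg xs∈V₀ γ Mγ≡0)
      Y≡0 : slack y γ ≡ 0ℚ
      Y≡0 = OnFγ⇒slack≡0 γ y (y-on γ (generic-γ′ γ γ≗γ′ γ-circuit (slack≡0⇒OnFγ γ xs S≡0)))

  face-by-circuit-hyperplanes : TotallyUnimodular M → ∀ {F} → IsFace M F → ∀ {y} → InV0 M y → (∀ γ → U M F γ → OnFγ M γ y) → F y
  face-by-circuit-hyperplanes TU {F} (c , h , c≤h , F⇔ , (x₀ , x₀∈F)) {y} y∈V₀ y-on =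
    Equivalence.from (F⇔ y) (y∈V₀ , decidable-stable (⟨ c , y ⟩ ℚ.≟ h)
      (generic-point {F} {c} {h} F⇔ x₀∈F (signVectors n) >>= λ (xs , xs∈F , generic) → return (on-hyperplane xs xs∈F generic)))
    where
    open +-*-Solver
    on-hyperplane : ∀ xs → F xs → All (Generic F xs) (signVectors n) → ⟨ c , y ⟩ ≡ h
    on-hyperplane xs xs∈F generic = ℚP.≤-antisym (c≤h y y∈V₀) (0≤q-p⇒p≤q (ℚP.*-cancelˡ-≤-pos t {{ℚ.positive t>0}}
      (subst₂ _≤_ (sym (ℚP.*-zeroʳ t)) (solve 3 (λ t h Y → h :- ((con 1ℚ :+ t) :* h :+ (con 1ℚ :- (con 1ℚ :+ t)) :* Y) := t :* (Y :- h)) refl t h ⟨ c , y ⟩)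
        (p≤q⇒0≤q-p (subst (_≤ h) c·z≡ (c≤h z z∈V₀))))))
      where
      t-margin : Σ ℚ λ t → 0ℚ < t × All (λ γ′ → 0ℚ < slack xs γ′ → t * ∣ slack y γ′ ∣ ≤ slack xs γ′) (signVectors n)
      t-margin = margin (slack xs) (slack y) (signVectors n)
      t : ℚ
      t = proj₁ t-margin
      t>0 : 0ℚ < t
      t>0 = proj₁ (proj₂ t-margin)
      z : QVec n
      z = affine (1ℚ + t) xs y
      z∈V₀ : InV0 M z
      z∈V₀ = extrapolate-in-V₀ TU {F} {c} {h} F⇔ xs∈F generic y∈V₀ y-on t>0 (proj₂ (proj₂ t-margin))
      c·z≡ : ⟨ c , z ⟩ ≡ (1ℚ + t) * h + (1ℚ - (1ℚ + t)) * ⟨ c , y ⟩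
      c·z≡ = trans (⟨⟩-affineʳ c (1ℚ + t) xs y) (cong (λ p → (1ℚ + t) * p + (1ℚ - (1ℚ + t)) * ⟨ c , y ⟩) (proj₂ (Equivalence.to (F⇔ xs) xs∈F)))

-- The map φ

Is0±1-sign : ∀ {a} → Is0±1 a → a ≢ ℤ.0ℤ → a ≡ ℤ.sign a ◃ 1
Is0±1-sign (inj₁ refl)        a≢0 = ⊥-elim (a≢0 refl)
Is0±1-sign (inj₂ (inj₁ refl)) _   = refl
Is0±1-sign (inj₂ (inj₂ refl)) _   = refl

module _ {m n : ℕ} (M : Matrix m n) where

  -- The circuit γ witnessing e ∈ φ(F) is itself the required positive dependency.
  φ-strongly-connected : ∀ F → PhiStronglyConnected M F
  φ-strongly-connected F e (γ , γ∈𝒰@((γ∈ , _ , Mγ≡0 , _) , _) , γe≢0) =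
    (λ f → ℤ.∣ γ f ∣) , (λ f → ℤ.sign (γ f)) , ℕP.n≢0⇒n>0 (γe≢0 ∘ ℤP.∣i∣≡0⇒i≡0) ,
    (λ f ∣γf∣≢0 → let γf≢0 = ∣γf∣≢0 ∘ cong ℤ.∣_∣ in (γ , γ∈𝒰 , γf≢0) , (γ , γ∈𝒰 , Is0±1-sign (γ∈ f) γf≢0)) ,
    λ i → toQ-injective (trans (toQ-sumℤ (λ f → M i f ℤ.* (ℤ.sign (γ f) ◃ ℤ.∣ γ f ∣))) (trans
      (sumℚ-cong (λ f → trans (cong (λ a → toQ (M i f ℤ.* a)) (ℤP.◃-inverse (γ f))) (toQ-* (M i f) (γ f))))
      (Mγ≡0 i)))

  φ-monotone : ∀ {F₁ F₂} → (∀ x → F₁ x → F₂ x) → PhiLE M F₁ F₂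
  φ-monotone F₁⊆F₂ = (λ e (γ , (γ-circuit , F₂⊆Fγ) , γe≢0) → γ , (γ-circuit , λ x → F₂⊆Fγ x ∘ F₁⊆F₂ x) , γe≢0)
                   , (λ e s (γ , (γ-circuit , F₂⊆Fγ) , γe≡s) → γ , (γ-circuit , λ x → F₂⊆Fγ x ∘ F₁⊆F₂ x) , γe≡s)

  -- x ∈ F₁ lies on the hyperplane of each γ ∈ 𝒰(F₂): every signed element of γ is carried by a circuit
  -- of 𝒰(F₁), whose hyperplane contains x.
  φ-reflects-⊆ : TotallyUnimodular M → ∀ {F₁ F₂} → IsFace M F₁ → IsFace M F₂ →
    (∀ e s → Orient M F₂ e s → Orient M F₁ e s) → ∀ x → F₁ x → F₂ x
  φ-reflects-⊆ TU {F₁} (_ , _ , _ , F₁⇔ , _) F₂-face orient₂⊆orient₁ x x∈F₁ =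
    face-by-circuit-hyperplanes M TU F₂-face x∈V₀ λ γ γ∈𝒰₂@(γ-circuit@(γ∈ , _) , _) →
      circuit-hyperplane M TU x∈V₀ γ-circuit λ e γe≢0 →
        let γe≡ = Is0±1-sign (γ∈ e) γe≢0
            δ , (δ-circuit , F₁⊆Fδ) , δe≡ = orient₂⊆orient₁ e (ℤ.sign (γ e)) (γ , γ∈𝒰₂ , γe≡)
        in δ , δ-circuit , F₁⊆Fδ x x∈F₁ , trans δe≡ (sym γe≡)
    where
    x∈V₀ : InV0 M x
    x∈V₀ = proj₁ (Equivalence.to (F₁⇔ x) x∈F₁)

corollary4p16 : ∀ {m n : ℕ} (M : Matrix m n) → TotallyUnimodular M →
    (∀ F → IsFace M F → PhiStronglyConnected M F) ×
    (∀ F₁ F₂ → IsFace M F₁ → IsFace M F₂ → PhiEq M F₁ F₂ → ∀ x → F₁ x ⇔ F₂ x) ×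
    (∀ F₁ F₂ → IsFace M F₁ → IsFace M F₂ → (∀ x → F₁ x → F₂ x) → PhiLE M F₁ F₂)
corollary4p16 M TU =
  (λ F _ → φ-strongly-connected M F) ,
  (λ F₁ F₂ F₁-face F₂-face (_ , orient₁⇔orient₂) x →
    mk⇔ (φ-reflects-⊆ M TU F₁-face F₂-face (λ e s → Equivalence.from (orient₁⇔orient₂ e s)) x)
        (φ-reflects-⊆ M TU F₂-face F₁-face (λ e s → Equivalence.to (orient₁⇔orient₂ e s)) x)) ,
  (λ F₁ F₂ _ _ → φ-monotone M)
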